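{- Let $k\geq1$, $\hat x\in D_{2k}^0$, $c\in\mathbb{N}$, and let $x$ be a Dyck subpath of $\hat x$ with $2\ell\ge 2$ steps at positions $a+1,a+2,\ldots,a+2\ell$ that starts and ends on the line $y=c$. Then the elements of $\{a+1,\ldots,a+2\ell\}$ appear consecutively in $\pi(\hat x)$. Moreover, if $c$ is even, then $\pi(\hat x)|_x=\pi(x)=\big(|u|+2,\ |u|+2-\pi(\overline{\mathrm{rev}}(u)),\ 1,\ |u|+2+\pi(v)\big)$, where $x=U\circ u\circ D\circ v$ is the canonical decomposition of $x$ (viewed as an element of $D_{2\ell}^0$). If $c$ is odd, then $\pi(\hat x)|_x=|x|+1-\pi(\overline{\mathrm{rev}}(x))$.
   Context: A lattice path with $n$ steps is a sequence $x=(x_1,\ldots,x_n)$ of steps, each either an up-step $U=(1,1)$ or a down-step $D=(1,-1)$, drawn in $\mathbb{Z}^2$ starting at the origin; step $x_i$ (at position $i$) goes from $(i-1,h_{i-1})$ to $(i,h_i)$. A step lies below the line $y=c$ if both endpoints have $y$-coordinate at most $c$; it touches the line $y=c$ if it starts or ends on it. $u_c(x)$, $d_c(x)$: number of up-steps, resp. down-steps, of $x$ starting on the line $y=c$. $L_{2m,m}$ (resp. $L_{2m,m+1}$): lattice paths with $2m$ steps, exactly $m$ (resp. $m+1$) of them up-steps. $D_{2m}^e$: paths in $L_{2m,m}$ with exactly $e$ down-steps below the line $y=0$. For $x\in L_{2m,m}\setminus D_{2m}^m$, $g(x)$ replaces by an up-step the $(d_0(x)+1)$-th (from the left) down-step of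 $x$ touching $y=0$; for $x'\in L_{2m,m+1}$, $h(x')$ replaces by a down-step the $u_1(x')$-th (from the left) up-step of $x'$ touching $y=1$; $f:=h\circ g$. $\mathrm{pos}(\gamma,x)$ is the position where $x$ and $\gamma(x)$ differ. For $x\in D_{2m}^0$: $x^0:=x$, $y^i:=g(x^i)$, $x^{i+1}:=h(y^i)$ ($0\le i\le m-1$), and $\pi(x):=(\mathrm{pos}(g,x^0),\mathrm{pos}(h,y^0),\ldots,\mathrm{pos}(g,x^{m-1}),\mathrm{pos}(h,y^{m-1}))$, a permutation of $\{1,\ldots,2m\}$; for the empty path $\pi$ is empty. For a sequence $\alpha=(\alpha_1,\ldots,\alpha_n)$, $|\alpha|=n$, $\alpha+c=c+\alpha=(\alpha_1+c,\ldots,\alpha_n+c)$ and $c-\alpha=(c-\alpha_1,\ldots,c-\alpha_n)$; commas between sequences denote concatenation. For a path $w$, $\overline{\mathrm{rev}}(w)$ reverses the order of the steps and exchanges up- and down-steps. A Dyck subpath of $\hat x$ is a contiguous subpath $x=(\hat x_{a+1},\ldots,\hat x_{a+2\ell})$ whose starting and ending points both lie on some line $y=c$ and which has no down-step below the line $y=c$; whenever $\pi$, $\overline{\mathrm{rev}}$ or the canonical decomposition are applied to $x$, $x$ is translated to start at the origin and regarded as an element of $D_{2\ell}^0$. Canonical decomposition of $w\in D_{2\ell}^0$, $\ell\ge1$: with $b$ the position of the first down-step of $w$ ending on $y=0$, $u:=(w_2,\ldots,w_{b-1})$, $v:=(w_{b+1},\ldots,w_{2\ell})$, $w=U\circ u\circ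 D\circ v$. If $\sigma$ is the subsequence of $\pi(\hat x)$ consisting of the entries in $\{a+1,\ldots,a+2\ell\}$, then $\pi(\hat x)|_x:=\sigma-a$ (entrywise). -}

module Defs where

open import Data.Bool using (Bool; true; false; _∧_; _∨_; T)
open import Data.Nat using (ℕ; zero; suc; _+_; _∸_; _<ᵇ_; _≤ᵇ_; ⌊_/2⌋)
open import Data.Integer as ℤ using (ℤ; +_)
open import Data.List using (List; []; _∷_; length; reverse; map; take; drop; filterᵇ)
open import Relation.Nullary.Decidable using (does)
open import Relation.Binary.PropositionalEquality using (_≡_)

-- Steps: U = (1,1), D = (1,-1)
data Step : Set where
  U D : Step

Path : Set
Path = List Step

flipStep : Step → Step
flipStep U = D
flipStep D = U

sameStep : Step → Step → Bool
sameStep U U = true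
sameStep D D = true
sameStep _ _ = false

move : Step → ℤ → ℤ
move U h = h ℤ.+ ℤ.1ℤ
move D h = h ℤ.- ℤ.1ℤ

infix 4 _==ℤ_ _≤ℤ_

_==ℤ_ : ℤ → ℤ → Bool
a ==ℤ b = does (a ℤ.≟ b)

_≤ℤ_ : ℤ → ℤ → Bool
a ≤ℤ b = does (a ℤ.≤? b)

heightFrom : ℤ → Path → ℤ
heightFrom h [] = h
heightFrom h (s ∷ ss) = heightFrom (move s h) ss

countU : Path → ℕ
countU [] = 0
countU (U ∷ ss) = suc (countU ss)
countU (D ∷ ss) = countU ss

-- number of steps of kind s starting on the line y = c (path started at height h);
-- u_c(x) = countStart U c 0 x, d_c(x) = countStart D c 0 x
countStart : Step → ℤ → ℤ → Path → ℕ
countStart s c h [] = 0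
countStart s c h (t ∷ ts) with sameStep s t ∧ (h ==ℤ c)
... | true  = suc (countStart s c (move t h) ts)
... | false = countStart s c (move t h) ts

downsBelow : ℤ → ℤ → Path → ℕ
downsBelow c h [] = 0
downsBelow c h (U ∷ ts) = downsBelow c (move U h) ts
downsBelow c h (D ∷ ts) with (h ≤ℤ c) ∧ (move D h ≤ℤ c)
... | true  = suc (downsBelow c (move D h) ts)
... | false = downsBelow c (move D h) ts

-- Position (1-based) of the step of kind s touching the line y = c (starting or
-- ending on it) that comes after skipping `skip` such steps, i.e. the (skip+1)-th
-- one from the left.
-- Returns 0 if no such step exists (outside the paper's domain).
nthTouch : Step → ℤ → ℕ → ℤ → ℕ → Path → ℕ
nthTouch s c skip h i [] = 0
nthTouch s c skip h i (t ∷ ts) with sameStep s t ∧ ((h ==ℤ c) ∨ (move t h ==ℤ c)) | skip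
... | true  | zero    = suc i
... | true  | suc sk  = nthTouch s c sk (move t h) (suc i) ts
... | false | _       = nthTouch s c skip (move t h) (suc i) ts

-- replace the step at (1-based) position p by the opposite step (p = 0: no change)
flipAt : ℕ → Path → Path
flipAt _ [] = []
flipAt zero xs = xs
flipAt (suc zero) (t ∷ ts) = flipStep t ∷ ts
flipAt (suc (suc n)) (t ∷ ts) = t ∷ flipAt (suc n) ts

-- pos(g,x): the (d_0(x)+1)-th down-step of x touching y = 0
posG : Path → ℕ
posG x = nthTouch D (+ 0) (countStart D (+ 0) (+ 0) x) (+ 0) 0 x

-- pos(h,x'): the u_1(x')-th up-step of x' touching y = 1
posH : Path → ℕ
posH x = nthTouch U (+ 1) (countStart U (+ 1) (+ 0) x ∸ 1) (+ 0) 0 x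

gMap : Path → Path
gMap x = flipAt (posG x) x

hMap : Path → Path
hMap x = flipAt (posH x) x

πIter : ℕ → Path → List ℕ
πIter zero x = []
πIter (suc i) x = posG x ∷ posH (gMap x) ∷ πIter i (hMap (gMap x))

πPerm : Path → List ℕ
πPerm x = πIter ⌊ length x /2⌋ x

InD0 : ℕ → Path → Set
InD0 m x = (length x ≡ m + m) × ((countU x ≡ m) × (downsBelow (+ 0) (+ 0) x ≡ 0))
  where open import Data.Product using (_×_)

revBar : Path → Path
revBar w = map flipStep (reverse w)

-- position (1-based) of the first down-step ending on y = 0 (0 if none)
firstReturn : ℤ → ℕ → Path → ℕ
firstReturn h i [] = 0
firstReturn h i (U ∷ ts) = firstReturn (move U h) (suc i) ts
firstReturn h i (D ∷ ts) with move D h ==ℤ (+ 0)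
... | true  = suc i
... | false = firstReturn (move D h) (suc i) ts

-- canonical decomposition w = U ∘ u ∘ D ∘ v
canonU : Path → Path
canonU w = take (firstReturn (+ 0) 0 w ∸ 2) (drop 1 w)

canonV : Path → Path
canonV w = drop (firstReturn (+ 0) 0 w) w

subpath : ℕ → ℕ → Path → Path
subpath a n p = take n (drop a p)

inRange : ℕ → ℕ → ℕ → Bool
inRange a n i = (a <ᵇ i) ∧ (i ≤ᵇ a + n)

restrict : ℕ → ℕ → List ℕ → List ℕ
restrict a n σ = map (λ i → i ∸ a) (filterᵇ (inRange a n) σ)

-- A Dyck path is dyck t for a binary tree t, with dyck (node u v) = U (dyck u) D (dyck v).  Running
-- the alternation g, h, g, … over a path whose prefix is already processed turns a block dyck t into
-- its mirror image and records a sequence normalSeq t that depends only on t; started with h on a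
-- block raised to height 1 it records reversedSeq t.  Both sequences are assembled from those of
-- the two subtrees by shifts and concatenation, so π(dyck t) = normalSeq t, and π of revBar (dyck t)
-- is the reflection i ↦ |t| + 1 − i of reversedSeq t.  A Dyck subpath of dyck T is reached by
-- descending from T into the subtree containing it until it is an initial segment dyck t of
-- dyck (t ++ r); there its positions form the leading block normalSeq t of normalSeq (t ++ r), and
-- every step back up only shifts this block and surrounds it by entries outside the window.  Each
-- descent into a left subtree lowers the height by one and exchanges the normal and reversed
-- sequences, which is why the parity of c decides which of the two appears.

module Submission where

open import Defs
open import Algebra.Bundles using (AbelianGroup)
open import Data.Bool using (Bool; true; false; _∧_; _∨_; T; not)
open import Data.Bool.Properties using (∧-zeroʳ; T-∧; not-involutive)
open import Data.Empty using (⊥-elim)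
open import Data.Integer as ℤ using (ℤ; +_)
import Data.Integer.Properties as ZP
open import Algebra.Properties.Group (AbelianGroup.group ZP.+-0-abelianGroup) using (∙-cancelʳ)
open import Data.List using (List; []; _∷_; _++_; length; map; reverse; take; drop; filterᵇ)
open import Data.List.Properties
  using (++-assoc; ++-identityʳ; ∷-injectiveʳ; length-++; length-map; length-reverse; length-take; length-drop;
         map-++; map-id; map-∘; map-cong; map-cong-local; reverse-++; take-take; take++drop≡id;
         filter-++; filter-all; filter-none)
open import Data.List.Relation.Unary.All using (All; []; _∷_)
import Data.List.Relation.Unary.All as All
open import Data.List.Relation.Unary.All.Properties using (++⁺; map⁺)
open import Data.Nat as ℕ using (ℕ; zero; suc; _+_; _∸_; _≤_; _<_; z≤n; s≤s; _%_; ⌊_/2⌋)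
import Data.Nat.Properties as NP
open import Data.Nat.DivMod using ([m+n]%n≡m%n)
open import Data.Nat.Tactic.RingSolver using (solve-∀)
open import Data.Product using (_×_; _,_; proj₁; proj₂; Σ; ∃-syntax)
open import Data.Unit using (tt)
open import Function.Bundles using (Equivalence)
open import Relation.Binary.PropositionalEquality
  using (_≡_; _≢_; ≢-sym; refl; sym; trans; cong; cong₂; subst; subst₂; module ≡-Reasoning)
open import Relation.Nullary using (¬_; yes; no)
open import Relation.Nullary.Decidable using (dec-true; dec-false; T?)

move-D-U : ∀ h → move D (move U h) ≡ h
move-D-U h = trans (ZP.+-assoc h ℤ.1ℤ ℤ.-1ℤ) (ZP.+-identityʳ h)

move-U-D : ∀ h → move U (move D h) ≡ h
move-U-D h = trans (ZP.+-assoc h ℤ.-1ℤ ℤ.1ℤ) (ZP.+-identityʳ h)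

<-move-U : ∀ h → h ℤ.< move U h
<-move-U h = subst (h ℤ.<_) (ZP.+-comm ℤ.1ℤ h) (ZP.suc[i]≤j⇒i<j ZP.≤-refl)

move-D-< : ∀ h → move D h ℤ.< h
move-D-< h = subst (ℤ._< h) (ZP.+-comm ℤ.-1ℤ h) (ZP.i≤pred[j]⇒i<j ZP.≤-refl)

move-+ : ∀ s h k → move s (h ℤ.+ k) ≡ move s h ℤ.+ k
move-+ U h k = trans (ZP.+-assoc h k ℤ.1ℤ) (trans (cong (λ z → h ℤ.+ z) (ZP.+-comm k ℤ.1ℤ)) (sym (ZP.+-assoc h ℤ.1ℤ k)))
move-+ D h k = trans (ZP.+-assoc h k ℤ.-1ℤ) (trans (cong (λ z → h ℤ.+ z) (ZP.+-comm k ℤ.-1ℤ)) (sym (ZP.+-assoc h ℤ.-1ℤ k)))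

move-U-+ : ∀ c n → move U (c ℤ.+ + n) ≡ c ℤ.+ + suc n
move-U-+ c n = trans (ZP.+-assoc c (+ n) (+ 1)) (cong (λ z → c ℤ.+ + z) (NP.+-comm n 1))

move-D-+ : ∀ c n → move D (c ℤ.+ + suc n) ≡ c ℤ.+ + n
move-D-+ c n = trans (cong (move D) (sym (move-U-+ c n))) (move-D-U (c ℤ.+ + n))

<-+-suc : ∀ c n → c ℤ.< c ℤ.+ + suc n
<-+-suc c n = subst (ℤ._< c ℤ.+ + suc n) (ZP.+-identityʳ c) (ZP.+-monoʳ-< c (ℤ.+<+ (s≤s z≤n)))

==ℤ-false : ∀ {a b} → a ≢ b → (a ==ℤ b) ≡ false
==ℤ-false = dec-false (_ ℤ.≟ _)

≤ℤ-true : ∀ {a b} → a ℤ.≤ b → (a ≤ℤ b) ≡ true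
≤ℤ-true = dec-true (_ ℤ.≤? _)

≤ℤ-false : ∀ {a b} → ¬ (a ℤ.≤ b) → (a ≤ℤ b) ≡ false
≤ℤ-false = dec-false (_ ℤ.≤? _)

T-not⇒¬T : ∀ {b} → T (not b) → ¬ T b
T-not⇒¬T {false} _ ()

¬T⇒T-not : ∀ {b} → ¬ T b → T (not b)
¬T⇒T-not {true}  ¬t = ¬t tt
¬T⇒T-not {false} _  = tt

take-length-++ : ∀ {A : Set} (xs ys : List A) → take (length xs) (xs ++ ys) ≡ xs
take-length-++ [] ys = refl
take-length-++ (x ∷ xs) ys = cong (x ∷_) (take-length-++ xs ys)

drop-suc-length-++ : ∀ {A : Set} (xs : List A) y ys → drop (suc (length xs)) (xs ++ y ∷ ys) ≡ ys
drop-suc-length-++ [] y ys = refl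
drop-suc-length-++ (x ∷ xs) y ys = drop-suc-length-++ xs y ys

take-++-≤ : ∀ {A : Set} j (xs ys : List A) → j ≤ length xs → take j (xs ++ ys) ≡ take j xs
take-++-≤ zero    xs       ys j≤ = refl
take-++-≤ (suc j) (x ∷ xs) ys (s≤s j≤) = cong (x ∷_) (take-++-≤ j xs ys j≤)

drop-++-≤ : ∀ {A : Set} j (xs ys : List A) → j ≤ length xs → drop j (xs ++ ys) ≡ drop j xs ++ ys
drop-++-≤ zero    xs       ys j≤ = refl
drop-++-≤ (suc j) (x ∷ xs) ys (s≤s j≤) = drop-++-≤ j xs ys j≤

take-length-+-++ : ∀ {A : Set} (xs : List A) j ys → take (length xs + j) (xs ++ ys) ≡ xs ++ take j ys
take-length-+-++ []       j ys = refl
take-length-+-++ (x ∷ xs) j ys = cong (x ∷_) (take-length-+-++ xs j ys)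

drop-length-+-++ : ∀ {A : Set} (xs : List A) j ys → drop (length xs + j) (xs ++ ys) ≡ drop j ys
drop-length-+-++ []       j ys = refl
drop-length-+-++ (x ∷ xs) j ys = drop-length-+-++ xs j ys

length-subpath : ∀ {A : Set} a n (xs : List A) → a + n ≤ length xs → length (take n (drop a xs)) ≡ n
length-subpath a n xs bound = trans (length-take n (drop a xs))
  (NP.m≤n⇒m⊓n≡m (subst (n ≤_) (sym (length-drop a xs)) (subst (_≤ length xs ∸ a) (NP.m+n∸m≡n a n) (NP.∸-monoˡ-≤ a bound))))

length-++-bracket : ∀ {A : Set} (P : List A) s s' xs → length (P ++ s ∷ xs ++ s' ∷ []) ≡ length P + (2 + length xs)
length-++-bracket P s s' xs = trans (length-++ P) (cong (λ z → length P + suc z) (trans (length-++ xs) (NP.+-comm (length xs) 1)))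

suc-length-++-∷ : ∀ {A : Set} (P : List A) s xs → suc (length (P ++ s ∷ xs)) ≡ length P + (2 + length xs)
suc-length-++-∷ P s xs = trans (cong suc (length-++ P)) (sym (NP.+-suc (length P) (suc (length xs))))

revBar-++ : ∀ xs ys → revBar (xs ++ ys) ≡ revBar ys ++ revBar xs
revBar-++ xs ys = trans (cong (map flipStep) (reverse-++ xs ys)) (map-++ flipStep (reverse ys) (reverse xs))

touchCount : Step → ℤ → ℤ → Path → ℕ
touchCount s c h [] = 0
touchCount s c h (t ∷ ts) with sameStep s t ∧ ((h ==ℤ c) ∨ (move t h ==ℤ c))
... | true  = suc (touchCount s c (move t h) ts)
... | false = touchCount s c (move t h) ts

countStart≤touchCount : ∀ s c h p → countStart s c h p ≤ touchCount s c h p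
countStart≤touchCount s c h [] = z≤n
countStart≤touchCount s c h (t ∷ ts) with sameStep s t | h ==ℤ c | move t h ==ℤ c
... | true  | true  | _     = s≤s (countStart≤touchCount s c (move t h) ts)
... | true  | false | true  = NP.m≤n⇒m≤1+n (countStart≤touchCount s c (move t h) ts)
... | true  | false | false = countStart≤touchCount s c (move t h) ts
... | false | _     | _     = countStart≤touchCount s c (move t h) ts

heightFrom-++ : ∀ h A B → heightFrom h (A ++ B) ≡ heightFrom (heightFrom h A) B
heightFrom-++ h [] B = refl
heightFrom-++ h (t ∷ A) B = heightFrom-++ (move t h) A B

heightFrom-+ : ∀ h k p → heightFrom (h ℤ.+ k) p ≡ heightFrom h p ℤ.+ k
heightFrom-+ h k [] = refl
heightFrom-+ h k (s ∷ p) = trans (cong (λ z → heightFrom z p) (move-+ s h k)) (heightFrom-+ (move s h) k p)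

countStart-++ : ∀ s c h A B → countStart s c h (A ++ B) ≡ countStart s c h A + countStart s c (heightFrom h A) B
countStart-++ s c h [] B = refl
countStart-++ s c h (t ∷ A) B with sameStep s t ∧ (h ==ℤ c)
... | true  = cong suc (countStart-++ s c (move t h) A B)
... | false = countStart-++ s c (move t h) A B

touchCount-++ : ∀ s c h A B → touchCount s c h (A ++ B) ≡ touchCount s c h A + touchCount s c (heightFrom h A) B
touchCount-++ s c h [] B = refl
touchCount-++ s c h (t ∷ A) B with sameStep s t ∧ ((h ==ℤ c) ∨ (move t h ==ℤ c))
... | true  = cong suc (touchCount-++ s c (move t h) A B)
... | false = touchCount-++ s c (move t h) A B

downsBelow-++ : ∀ c h A B → downsBelow c h (A ++ B) ≡ downsBelow c h A + downsBelow c (heightFrom h A) B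
downsBelow-++ c h [] B = refl
downsBelow-++ c h (U ∷ A) B = downsBelow-++ c (move U h) A B
downsBelow-++ c h (D ∷ A) B with (h ≤ℤ c) ∧ (move D h ≤ℤ c)
... | true  = cong suc (downsBelow-++ c (move D h) A B)
... | false = downsBelow-++ c (move D h) A B

countStart-off : ∀ s c h t ts → h ≢ c → countStart s c h (t ∷ ts) ≡ countStart s c (move t h) ts
countStart-off s c h t ts h≢c rewrite ==ℤ-false h≢c | ∧-zeroʳ (sameStep s t) = refl

touchCount-off : ∀ s c h t ts → h ≢ c → move t h ≢ c → touchCount s c h (t ∷ ts) ≡ touchCount s c (move t h) ts
touchCount-off s c h t ts h≢c h'≢c rewrite ==ℤ-false h≢c | ==ℤ-false h'≢c | ∧-zeroʳ (sameStep s t) = refl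

downsBelow-D-above : ∀ c h ts → c ℤ.< h → downsBelow c h (D ∷ ts) ≡ downsBelow c (move D h) ts
downsBelow-D-above c h ts c<h rewrite ≤ℤ-false (ZP.<⇒≱ c<h) = refl

downsBelow-D-on : ∀ c ts → downsBelow c c (D ∷ ts) ≡ suc (downsBelow c (move D c) ts)
downsBelow-D-on c ts rewrite ≤ℤ-true (ZP.≤-refl {c}) | ≤ℤ-true (ZP.<⇒≤ (move-D-< c)) = refl

countD : Path → ℕ
countD [] = 0
countD (U ∷ p) = countD p
countD (D ∷ p) = suc (countD p)

length≡countU+countD : ∀ p → length p ≡ countU p + countD p
length≡countU+countD [] = refl
length≡countU+countD (U ∷ p) = cong suc (length≡countU+countD p)
length≡countU+countD (D ∷ p) = trans (cong suc (length≡countU+countD p)) (sym (NP.+-suc (countU p) (countD p)))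

heightFrom-+-countD : ∀ h p → heightFrom h p ℤ.+ + countD p ≡ h ℤ.+ + countU p
heightFrom-+-countD h [] = refl
heightFrom-+-countD h (U ∷ p) = trans (heightFrom-+-countD (move U h) p) (ZP.+-assoc h (+ 1) (+ countU p))
heightFrom-+-countD h (D ∷ p) = begin
  heightFrom (move D h) p ℤ.+ + suc (countD p)         ≡⟨ cong (λ z → heightFrom (move D h) p ℤ.+ z) (cong +_ (NP.+-comm 1 (countD p))) ⟩
  heightFrom (move D h) p ℤ.+ (+ countD p ℤ.+ + 1)     ≡⟨ sym (ZP.+-assoc (heightFrom (move D h) p) (+ countD p) (+ 1)) ⟩
  (heightFrom (move D h) p ℤ.+ + countD p) ℤ.+ + 1     ≡⟨ cong (ℤ._+ + 1) (heightFrom-+-countD (move D h) p) ⟩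
  (move D h ℤ.+ + countU p) ℤ.+ + 1                    ≡⟨ ZP.+-assoc (move D h) (+ countU p) (+ 1) ⟩
  move D h ℤ.+ (+ countU p ℤ.+ + 1)                    ≡⟨ cong (λ z → move D h ℤ.+ z) (ZP.+-comm (+ countU p) (+ 1)) ⟩
  move D h ℤ.+ (+ 1 ℤ.+ + countU p)                    ≡⟨ sym (ZP.+-assoc (move D h) (+ 1) (+ countU p)) ⟩
  move U (move D h) ℤ.+ + countU p                     ≡⟨ cong (ℤ._+ + countU p) (move-U-D h) ⟩
  h ℤ.+ + countU p ∎
  where open ≡-Reasoning

Touches : Step → ℤ → ℤ → Set
Touches s c h = ((h ==ℤ c) ∨ (move s h ==ℤ c)) ≡ true

nthTouch-after : ∀ s c h i A B → Touches s c (heightFrom h A) →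
  nthTouch s c (touchCount s c h A) h i (A ++ s ∷ B) ≡ suc (i + length A)
nthTouch-after U c h i [] B t rewrite t | NP.+-identityʳ i = refl
nthTouch-after D c h i [] B t rewrite t | NP.+-identityʳ i = refl
nthTouch-after s c h i (a ∷ A) B t with sameStep s a ∧ ((h ==ℤ c) ∨ (move a h ==ℤ c))
... | true  = trans (nthTouch-after s c (move a h) (suc i) A B t) (cong suc (sym (NP.+-suc i (length A))))
... | false = trans (nthTouch-after s c (move a h) (suc i) A B t) (cong suc (sym (NP.+-suc i (length A))))

flipAt-after : ∀ A t B → flipAt (suc (length A)) (A ++ t ∷ B) ≡ A ++ flipStep t ∷ B
flipAt-after [] t B = refl
flipAt-after (a ∷ A) t B = cong (a ∷_) (flipAt-after A t B)

d₀ u₁ touchD₀ touchU₁ : ℤ → Path → ℕ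
d₀ = countStart D (+ 0)
u₁ = countStart U (+ 1)
touchD₀ = touchCount D (+ 0)
touchU₁ = touchCount U (+ 1)

g-after : ∀ A B → d₀ (+ 0) (A ++ D ∷ B) ≡ touchD₀ (+ 0) A → Touches D (+ 0) (heightFrom (+ 0) A) →
  (posG (A ++ D ∷ B) ≡ suc (length A)) × (gMap (A ++ D ∷ B) ≡ A ++ U ∷ B)
g-after A B skip t = pos , trans (cong (λ k → flipAt k (A ++ D ∷ B)) pos) (flipAt-after A D B)
  where
    pos : posG (A ++ D ∷ B) ≡ suc (length A)
    pos = trans (cong (λ k → nthTouch D (+ 0) k (+ 0) 0 (A ++ D ∷ B)) skip) (nthTouch-after D (+ 0) (+ 0) 0 A B t)

h-after : ∀ A B → u₁ (+ 0) (A ++ U ∷ B) ≡ suc (touchU₁ (+ 0) A) → Touches U (+ 1) (heightFrom (+ 0) A) →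
  (posH (A ++ U ∷ B) ≡ suc (length A)) × (hMap (A ++ U ∷ B) ≡ A ++ D ∷ B)
h-after A B skip t = pos , trans (cong (λ k → flipAt k (A ++ U ∷ B)) pos) (flipAt-after A U B)
  where
    pos : posH (A ++ U ∷ B) ≡ suc (length A)
    pos = trans (cong (λ k → nthTouch U (+ 1) (k ∸ 1) (+ 0) 0 (A ++ U ∷ B)) skip) (nthTouch-after U (+ 1) (+ 0) 0 A B t)

-- Dyck paths as binary trees

data Tree : Set where
  leaf : Tree
  node : Tree → Tree → Tree

dyck : Tree → Path
dyck leaf = []
dyck (node u v) = U ∷ dyck u ++ D ∷ dyck v

size : Tree → ℕ
size leaf = 0
size (node u v) = suc (size u + suc (size v))

mirror : Path → Path
mirror = map flipStep

length-dyck : ∀ t → length (dyck t) ≡ size t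
length-dyck leaf = refl
length-dyck (node u v) = cong suc (trans (length-++ (dyck u)) (cong₂ _+_ (length-dyck u) (cong suc (length-dyck v))))

length-mirror-dyck : ∀ t → length (mirror (dyck t)) ≡ size t
length-mirror-dyck t = trans (length-map flipStep (dyck t)) (length-dyck t)

mirror-dyck-node : ∀ u v → mirror (dyck (node u v)) ≡ D ∷ mirror (dyck u) ++ U ∷ mirror (dyck v)
mirror-dyck-node u v = cong (D ∷_) (map-++ flipStep (dyck u) (D ∷ dyck v))

size-node : ∀ u v → size (node u v) ≡ 2 + size u + size v
size-node u v = cong suc (NP.+-suc (size u) (size v))

hump : Tree → Path
hump u = U ∷ dyck u ++ D ∷ []

dyck-node-hump : ∀ u v → dyck (node u v) ≡ hump u ++ dyck v
dyck-node-hump u v = cong (U ∷_) (sym (++-assoc (dyck u) (D ∷ []) (dyck v)))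

length-hump : ∀ u → length (hump u) ≡ 2 + size u
length-hump u = trans (length-++-bracket [] U D (dyck u)) (cong (λ k → 2 + k) (length-dyck u))

++-dyck-node : ∀ P u v Q → P ++ dyck (node u v) ++ Q ≡ (P ++ U ∷ dyck u ++ D ∷ []) ++ dyck v ++ Q
++-dyck-node P u v Q = begin
  P ++ U ∷ (dyck u ++ D ∷ dyck v) ++ Q       ≡⟨ cong (λ z → P ++ U ∷ z) (++-assoc (dyck u) (D ∷ dyck v) Q) ⟩
  P ++ U ∷ dyck u ++ D ∷ dyck v ++ Q         ≡⟨ cong (λ z → P ++ U ∷ z) (sym (++-assoc (dyck u) (D ∷ []) (dyck v ++ Q))) ⟩
  P ++ (U ∷ dyck u ++ D ∷ []) ++ dyck v ++ Q ≡⟨ sym (++-assoc P (U ∷ dyck u ++ D ∷ []) _) ⟩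
  (P ++ U ∷ dyck u ++ D ∷ []) ++ dyck v ++ Q ∎
  where open ≡-Reasoning

++-mirror-dyck-node : ∀ P u v Q → (P ++ D ∷ mirror (dyck u) ++ U ∷ []) ++ mirror (dyck v) ++ Q ≡ P ++ mirror (dyck (node u v)) ++ Q
++-mirror-dyck-node P u v Q = begin
  (P ++ D ∷ mirror (dyck u) ++ U ∷ []) ++ mirror (dyck v) ++ Q ≡⟨ ++-assoc P _ _ ⟩
  P ++ D ∷ (mirror (dyck u) ++ U ∷ []) ++ mirror (dyck v) ++ Q ≡⟨ cong (λ z → P ++ D ∷ z) (++-assoc (mirror (dyck u)) (U ∷ []) _) ⟩
  P ++ D ∷ mirror (dyck u) ++ U ∷ mirror (dyck v) ++ Q         ≡⟨ cong (λ z → P ++ D ∷ z) (sym (++-assoc (mirror (dyck u)) (U ∷ mirror (dyck v)) Q)) ⟩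
  P ++ (D ∷ mirror (dyck u) ++ U ∷ mirror (dyck v)) ++ Q       ≡⟨ cong (λ z → P ++ z ++ Q) (sym (mirror-dyck-node u v)) ⟩
  P ++ mirror (dyck (node u v)) ++ Q ∎
  where open ≡-Reasoning

revBar-dyck-node : ∀ u v → revBar (dyck (node u v)) ≡ revBar (dyck v) ++ U ∷ revBar (dyck u) ++ D ∷ []
revBar-dyck-node u v = begin
  revBar ((U ∷ []) ++ dyck u ++ (D ∷ []) ++ dyck v)               ≡⟨ revBar-++ (U ∷ []) (dyck u ++ D ∷ dyck v) ⟩
  revBar (dyck u ++ (D ∷ []) ++ dyck v) ++ D ∷ []                 ≡⟨ cong (_++ D ∷ []) (revBar-++ (dyck u) (D ∷ dyck v)) ⟩
  (revBar ((D ∷ []) ++ dyck v) ++ revBar (dyck u)) ++ D ∷ []      ≡⟨ cong (λ z → (z ++ revBar (dyck u)) ++ D ∷ []) (revBar-++ (D ∷ []) (dyck v)) ⟩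
  ((revBar (dyck v) ++ U ∷ []) ++ revBar (dyck u)) ++ D ∷ []      ≡⟨ trans (++-assoc (revBar (dyck v) ++ U ∷ []) _ _) (++-assoc (revBar (dyck v)) (U ∷ []) _) ⟩
  revBar (dyck v) ++ U ∷ revBar (dyck u) ++ D ∷ [] ∎
  where open ≡-Reasoning

heightFrom-dyck : ∀ t h → heightFrom h (dyck t) ≡ h
heightFrom-dyck leaf h = refl
heightFrom-dyck (node u v) h
  rewrite heightFrom-++ (move U h) (dyck u) (D ∷ dyck v) | heightFrom-dyck u (move U h) | move-D-U h = heightFrom-dyck v h

heightFrom-mirror-dyck : ∀ t h → heightFrom h (mirror (dyck t)) ≡ h
heightFrom-mirror-dyck leaf h = refl
heightFrom-mirror-dyck (node u v) h
  rewrite map-++ flipStep (dyck u) (D ∷ dyck v) | heightFrom-++ (move D h) (mirror (dyck u)) (U ∷ mirror (dyck v))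
        | heightFrom-mirror-dyck u (move D h) | move-U-D h = heightFrom-mirror-dyck v h

heightFrom-hump : ∀ u → heightFrom (+ 0) (hump u) ≡ + 0
heightFrom-hump u rewrite heightFrom-++ (+ 1) (dyck u) (D ∷ []) | heightFrom-dyck u (+ 1) = refl

touchCount-dyck-above : ∀ s c t h → c ℤ.< h → touchCount s c h (dyck t) ≡ 0
touchCount-dyck-above s c leaf h c<h = refl
touchCount-dyck-above s c (node u v) h c<h = begin
  touchCount s c h (U ∷ dyck u ++ D ∷ dyck v)
    ≡⟨ touchCount-off s c h U _ (≢-sym (ZP.<⇒≢ c<h)) (≢-sym (ZP.<⇒≢ c<h')) ⟩
  touchCount s c (move U h) (dyck u ++ D ∷ dyck v)
    ≡⟨ touchCount-++ s c (move U h) (dyck u) (D ∷ dyck v) ⟩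
  touchCount s c (move U h) (dyck u) + touchCount s c (heightFrom (move U h) (dyck u)) (D ∷ dyck v)
    ≡⟨ cong₂ _+_ (touchCount-dyck-above s c u (move U h) c<h') (cong (λ z → touchCount s c z (D ∷ dyck v)) (heightFrom-dyck u (move U h))) ⟩
  touchCount s c (move U h) (D ∷ dyck v)
    ≡⟨ touchCount-off s c (move U h) D _ (≢-sym (ZP.<⇒≢ c<h')) (subst (_≢ c) (sym (move-D-U h)) (≢-sym (ZP.<⇒≢ c<h))) ⟩
  touchCount s c (move D (move U h)) (dyck v)
    ≡⟨ cong (λ z → touchCount s c z (dyck v)) (move-D-U h) ⟩
  touchCount s c h (dyck v)
    ≡⟨ touchCount-dyck-above s c v h c<h ⟩
  0 ∎
  where
    open ≡-Reasoning
    c<h' : c ℤ.< move U h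
    c<h' = ZP.<-trans c<h (<-move-U h)

touchCount-mirror-dyck-below : ∀ s c t h → h ℤ.< c → touchCount s c h (mirror (dyck t)) ≡ 0
touchCount-mirror-dyck-below s c leaf h h<c = refl
touchCount-mirror-dyck-below s c (node u v) h h<c = begin
  touchCount s c h (mirror (dyck (node u v)))
    ≡⟨ cong (touchCount s c h) (mirror-dyck-node u v) ⟩
  touchCount s c h (D ∷ mirror (dyck u) ++ U ∷ mirror (dyck v))
    ≡⟨ touchCount-off s c h D _ (ZP.<⇒≢ h<c) (ZP.<⇒≢ h'<c) ⟩
  touchCount s c (move D h) (mirror (dyck u) ++ U ∷ mirror (dyck v))
    ≡⟨ touchCount-++ s c (move D h) (mirror (dyck u)) (U ∷ mirror (dyck v)) ⟩
  touchCount s c (move D h) (mirror (dyck u)) + touchCount s c (heightFrom (move D h) (mirror (dyck u))) (U ∷ mirror (dyck v))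
    ≡⟨ cong₂ _+_ (touchCount-mirror-dyck-below s c u (move D h) h'<c) (cong (λ z → touchCount s c z (U ∷ mirror (dyck v))) (heightFrom-mirror-dyck u (move D h))) ⟩
  touchCount s c (move D h) (U ∷ mirror (dyck v))
    ≡⟨ touchCount-off s c (move D h) U _ (ZP.<⇒≢ h'<c) (subst (_≢ c) (sym (move-U-D h)) (ZP.<⇒≢ h<c)) ⟩
  touchCount s c (move U (move D h)) (mirror (dyck v))
    ≡⟨ cong (λ z → touchCount s c z (mirror (dyck v))) (move-U-D h) ⟩
  touchCount s c h (mirror (dyck v))
    ≡⟨ touchCount-mirror-dyck-below s c v h h<c ⟩
  0 ∎
  where
    open ≡-Reasoning
    h'<c : move D h ℤ.< c
    h'<c = ZP.<-trans (move-D-< h) h<c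

countStart-dyck-above : ∀ s c t h → c ℤ.< h → countStart s c h (dyck t) ≡ 0
countStart-dyck-above s c t h c<h =
  NP.n≤0⇒n≡0 (subst (countStart s c h (dyck t) ≤_) (touchCount-dyck-above s c t h c<h) (countStart≤touchCount s c h (dyck t)))

countStart-mirror-dyck-below : ∀ s c t h → h ℤ.< c → countStart s c h (mirror (dyck t)) ≡ 0
countStart-mirror-dyck-below s c t h h<c =
  NP.n≤0⇒n≡0 (subst (countStart s c h (mirror (dyck t)) ≤_) (touchCount-mirror-dyck-below s c t h h<c) (countStart≤touchCount s c h (mirror (dyck t))))

countStart-D-dyck-base : ∀ t h → countStart D h h (dyck t) ≡ 0
countStart-D-dyck-base leaf h = refl
countStart-D-dyck-base (node u v) h
  rewrite countStart-++ D h (move U h) (dyck u) (D ∷ dyck v) | heightFrom-dyck u (move U h)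
        | countStart-dyck-above D h u (move U h) (<-move-U h)
        | countStart-off D h (move U h) D (dyck v) (≢-sym (ZP.<⇒≢ (<-move-U h))) | move-D-U h = countStart-D-dyck-base v h

countStart-U-mirror-dyck-base : ∀ t h → countStart U h h (mirror (dyck t)) ≡ 0
countStart-U-mirror-dyck-base leaf h = refl
countStart-U-mirror-dyck-base (node u v) h
  rewrite map-++ flipStep (dyck u) (D ∷ dyck v)
        | countStart-++ U h (move D h) (mirror (dyck u)) (U ∷ mirror (dyck v)) | heightFrom-mirror-dyck u (move D h)
        | countStart-mirror-dyck-below U h u (move D h) (move-D-< h)
        | countStart-off U h (move D h) U (mirror (dyck v)) (ZP.<⇒≢ (move-D-< h)) | move-U-D h = countStart-U-mirror-dyck-base v h

countStart≡touchCount-D-mirror-dyck-base : ∀ t h → countStart D h h (mirror (dyck t)) ≡ touchCount D h h (mirror (dyck t))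
countStart≡touchCount-D-mirror-dyck-base leaf h = refl
countStart≡touchCount-D-mirror-dyck-base (node u v) h
  rewrite map-++ flipStep (dyck u) (D ∷ dyck v) | dec-true (h ℤ.≟ h) refl
        | countStart-++ D h (move D h) (mirror (dyck u)) (U ∷ mirror (dyck v))
        | touchCount-++ D h (move D h) (mirror (dyck u)) (U ∷ mirror (dyck v)) | heightFrom-mirror-dyck u (move D h)
        | countStart-mirror-dyck-below D h u (move D h) (move-D-< h) | touchCount-mirror-dyck-below D h u (move D h) (move-D-< h)
        | countStart-off D h (move D h) U (mirror (dyck v)) (ZP.<⇒≢ (move-D-< h))
        | move-U-D h = cong suc (countStart≡touchCount-D-mirror-dyck-base v h)

-- Running g and h over a block

-- P is the processed prefix and Q the untouched rest of the path.  Each count on Q is taken at the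
-- height Q sits at when the corresponding map (g for d₀, h for u₁) is next applied; the equations say
-- that the skip count of that map is then used up exactly by the touching steps inside P.
record NormalFrame (P Q : Path) : Set where
  constructor normalFrame
  field
    height : heightFrom (+ 0) P ≡ + 0
    downs  : d₀ (+ 0) P + d₀ (+ 0) Q ≡ touchD₀ (+ 0) P
    ups    : u₁ (+ 0) P + u₁ (+ 2) Q ≡ touchU₁ (+ 0) P

record ReversedFrame (P Q : Path) : Set where
  constructor reversedFrame
  field
    height : heightFrom (+ 0) P ≡ + 1
    downs  : d₀ (+ 0) P + d₀ ℤ.-1ℤ Q ≡ touchD₀ (+ 0) P
    ups    : u₁ (+ 0) P + u₁ (+ 1) Q ≡ touchU₁ (+ 0) P

private
  0<1 : + 0 ℤ.< + 1
  0<1 = ℤ.+<+ (s≤s z≤n)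
  0<2 : + 0 ℤ.< + 2
  0<2 = ℤ.+<+ (s≤s z≤n)
  1<2 : + 1 ℤ.< + 2
  1<2 = ℤ.+<+ (s≤s (s≤s z≤n))

  +-slide : ∀ a b t k → a + b ≡ t → a + k + b ≡ t + k
  +-slide a b t k e = trans (+-rearrange a k b) (cong (_+ k) e)
    where
      +-rearrange : ∀ a k b → a + k + b ≡ a + b + k
      +-rearrange = solve-∀

  +-slide-suc : ∀ a b t k → a + b ≡ t → a + k + suc b ≡ t + suc k
  +-slide-suc a b t k e = trans (+-rearrange a k b) (cong (_+ suc k) e)
    where
      +-rearrange : ∀ a k b → a + k + suc b ≡ a + b + suc k
      +-rearrange = solve-∀

  +-suc-slide : ∀ a b t → a + b ≡ t → a + suc b ≡ suc t
  +-suc-slide a b t e = trans (NP.+-suc a b) (cong suc e)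

normal-skipG : ∀ {P Q} u v → NormalFrame P Q →
  d₀ (+ 0) (P ++ (U ∷ dyck u ++ D ∷ dyck v) ++ Q) ≡ touchD₀ (+ 0) (P ++ U ∷ dyck u)
normal-skipG {P} {Q} u v (normalFrame hP dP _)
  rewrite countStart-++ D (+ 0) (+ 0) P ((U ∷ dyck u ++ D ∷ dyck v) ++ Q) | touchCount-++ D (+ 0) (+ 0) P (U ∷ dyck u) | hP
        | countStart-++ D (+ 0) (+ 1) (dyck u ++ D ∷ dyck v) Q | countStart-++ D (+ 0) (+ 1) (dyck u) (D ∷ dyck v)
        | heightFrom-++ (+ 1) (dyck u) (D ∷ dyck v) | heightFrom-dyck u (+ 1)
        | countStart-dyck-above D (+ 0) u (+ 1) 0<1 | touchCount-dyck-above D (+ 0) u (+ 1) 0<1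
        | countStart-D-dyck-base v (+ 0) | heightFrom-dyck v (+ 0) = trans dP (sym (NP.+-identityʳ _))

normal→reversed : ∀ {P Q} v → NormalFrame P Q → ReversedFrame (P ++ U ∷ []) (U ∷ dyck v ++ Q)
normal→reversed {P} {Q} v (normalFrame hP dP uP) = reversedFrame height downs ups
  where
    height : heightFrom (+ 0) (P ++ U ∷ []) ≡ + 1
    height rewrite heightFrom-++ (+ 0) P (U ∷ []) | hP = refl
    downs : d₀ (+ 0) (P ++ U ∷ []) + d₀ ℤ.-1ℤ (U ∷ dyck v ++ Q) ≡ touchD₀ (+ 0) (P ++ U ∷ [])
    downs rewrite countStart-++ D (+ 0) (+ 0) P (U ∷ []) | touchCount-++ D (+ 0) (+ 0) P (U ∷ [])
                | countStart-++ D (+ 0) (+ 0) (dyck v) Q | countStart-D-dyck-base v (+ 0) | heightFrom-dyck v (+ 0)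
                = +-slide (d₀ (+ 0) P) (d₀ (+ 0) Q) (touchD₀ (+ 0) P) 0 dP
    ups : u₁ (+ 0) (P ++ U ∷ []) + u₁ (+ 1) (U ∷ dyck v ++ Q) ≡ touchU₁ (+ 0) (P ++ U ∷ [])
    ups rewrite countStart-++ U (+ 1) (+ 0) P (U ∷ []) | touchCount-++ U (+ 1) (+ 0) P (U ∷ []) | hP
              | countStart-++ U (+ 1) (+ 2) (dyck v) Q | countStart-dyck-above U (+ 1) v (+ 2) 1<2 | heightFrom-dyck v (+ 2)
              = +-slide-suc (u₁ (+ 0) P) (u₁ (+ 2) Q) (touchU₁ (+ 0) P) 0 uP

normal-skipH : ∀ {P Q} u v → NormalFrame P Q →
  u₁ (+ 0) (P ++ U ∷ (mirror (dyck u) ++ U ∷ dyck v ++ Q)) ≡ suc (touchU₁ (+ 0) P)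
normal-skipH {P} {Q} u v (normalFrame hP _ uP)
  rewrite countStart-++ U (+ 1) (+ 0) P (U ∷ (mirror (dyck u) ++ U ∷ dyck v ++ Q)) | hP
        | countStart-++ U (+ 1) (+ 1) (mirror (dyck u)) (U ∷ dyck v ++ Q) | countStart-U-mirror-dyck-base u (+ 1)
        | heightFrom-mirror-dyck u (+ 1)
        | countStart-++ U (+ 1) (+ 2) (dyck v) Q | countStart-dyck-above U (+ 1) v (+ 2) 1<2 | heightFrom-dyck v (+ 2)
        = +-suc-slide (u₁ (+ 0) P) (u₁ (+ 2) Q) (touchU₁ (+ 0) P) uP

normal-next : ∀ {P Q} u → NormalFrame P Q → NormalFrame (P ++ D ∷ mirror (dyck u) ++ U ∷ []) Q
normal-next {P} {Q} u (normalFrame hP dP uP) = normalFrame height downs ups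
  where
    P' = P ++ D ∷ mirror (dyck u) ++ U ∷ []
    height : heightFrom (+ 0) P' ≡ + 0
    height rewrite heightFrom-++ (+ 0) P (D ∷ mirror (dyck u) ++ U ∷ []) | hP
                 | heightFrom-++ ℤ.-1ℤ (mirror (dyck u)) (U ∷ []) | heightFrom-mirror-dyck u ℤ.-1ℤ = refl
    downs : d₀ (+ 0) P' + d₀ (+ 0) Q ≡ touchD₀ (+ 0) P'
    downs rewrite countStart-++ D (+ 0) (+ 0) P (D ∷ mirror (dyck u) ++ U ∷ []) | touchCount-++ D (+ 0) (+ 0) P (D ∷ mirror (dyck u) ++ U ∷ []) | hP
                | countStart-++ D (+ 0) ℤ.-1ℤ (mirror (dyck u)) (U ∷ []) | touchCount-++ D (+ 0) ℤ.-1ℤ (mirror (dyck u)) (U ∷ [])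
                | countStart-mirror-dyck-below D (+ 0) u ℤ.-1ℤ ℤ.-<+ | touchCount-mirror-dyck-below D (+ 0) u ℤ.-1ℤ ℤ.-<+
                = +-slide (d₀ (+ 0) P) (d₀ (+ 0) Q) (touchD₀ (+ 0) P) 1 dP
    ups : u₁ (+ 0) P' + u₁ (+ 2) Q ≡ touchU₁ (+ 0) P'
    ups rewrite countStart-++ U (+ 1) (+ 0) P (D ∷ mirror (dyck u) ++ U ∷ []) | touchCount-++ U (+ 1) (+ 0) P (D ∷ mirror (dyck u) ++ U ∷ []) | hP
              | countStart-++ U (+ 1) ℤ.-1ℤ (mirror (dyck u)) (U ∷ []) | touchCount-++ U (+ 1) ℤ.-1ℤ (mirror (dyck u)) (U ∷ [])
              | countStart-mirror-dyck-below U (+ 1) u ℤ.-1ℤ ℤ.-<+ | touchCount-mirror-dyck-below U (+ 1) u ℤ.-1ℤ ℤ.-<+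
              | heightFrom-mirror-dyck u ℤ.-1ℤ
              = +-slide (u₁ (+ 0) P) (u₁ (+ 2) Q) (touchU₁ (+ 0) P) 0 uP

reversed-next : ∀ {P Q} u → ReversedFrame P Q → ReversedFrame (P ++ U ∷ dyck u ++ D ∷ []) Q
reversed-next {P} {Q} u (reversedFrame hP dP uP) = reversedFrame height downs ups
  where
    P' = P ++ U ∷ dyck u ++ D ∷ []
    height : heightFrom (+ 0) P' ≡ + 1
    height rewrite heightFrom-++ (+ 0) P (U ∷ dyck u ++ D ∷ []) | hP
                 | heightFrom-++ (+ 2) (dyck u) (D ∷ []) | heightFrom-dyck u (+ 2) = refl
    downs : d₀ (+ 0) P' + d₀ ℤ.-1ℤ Q ≡ touchD₀ (+ 0) P'
    downs rewrite countStart-++ D (+ 0) (+ 0) P (U ∷ dyck u ++ D ∷ []) | touchCount-++ D (+ 0) (+ 0) P (U ∷ dyck u ++ D ∷ []) | hP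
                | countStart-++ D (+ 0) (+ 2) (dyck u) (D ∷ []) | touchCount-++ D (+ 0) (+ 2) (dyck u) (D ∷ [])
                | countStart-dyck-above D (+ 0) u (+ 2) 0<2 | touchCount-dyck-above D (+ 0) u (+ 2) 0<2 | heightFrom-dyck u (+ 2)
                = +-slide (d₀ (+ 0) P) (d₀ ℤ.-1ℤ Q) (touchD₀ (+ 0) P) 0 dP
    ups : u₁ (+ 0) P' + u₁ (+ 1) Q ≡ touchU₁ (+ 0) P'
    ups rewrite countStart-++ U (+ 1) (+ 0) P (U ∷ dyck u ++ D ∷ []) | touchCount-++ U (+ 1) (+ 0) P (U ∷ dyck u ++ D ∷ []) | hP
              | countStart-++ U (+ 1) (+ 2) (dyck u) (D ∷ []) | touchCount-++ U (+ 1) (+ 2) (dyck u) (D ∷ [])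
              | countStart-dyck-above U (+ 1) u (+ 2) 1<2 | touchCount-dyck-above U (+ 1) u (+ 2) 1<2
              = +-slide (u₁ (+ 0) P) (u₁ (+ 1) Q) (touchU₁ (+ 0) P) 1 uP

reversed-skipH : ∀ {P Q} u v → ReversedFrame P Q →
  u₁ (+ 0) (P ++ U ∷ (dyck u ++ D ∷ mirror (dyck v) ++ Q)) ≡ suc (touchU₁ (+ 0) P)
reversed-skipH {P} {Q} u v (reversedFrame hP _ uP)
  rewrite countStart-++ U (+ 1) (+ 0) P (U ∷ (dyck u ++ D ∷ mirror (dyck v) ++ Q)) | hP
        | countStart-++ U (+ 1) (+ 2) (dyck u) (D ∷ mirror (dyck v) ++ Q) | countStart-dyck-above U (+ 1) u (+ 2) 1<2 | heightFrom-dyck u (+ 2)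
        | countStart-++ U (+ 1) (+ 1) (mirror (dyck v)) Q | countStart-U-mirror-dyck-base v (+ 1) | heightFrom-mirror-dyck v (+ 1)
        = +-suc-slide (u₁ (+ 0) P) (u₁ (+ 1) Q) (touchU₁ (+ 0) P) uP

reversed→normal : ∀ {P Q} v → ReversedFrame P Q → NormalFrame (P ++ D ∷ []) (D ∷ mirror (dyck v) ++ Q)
reversed→normal {P} {Q} v (reversedFrame hP dP uP) = normalFrame height downs ups
  where
    height : heightFrom (+ 0) (P ++ D ∷ []) ≡ + 0
    height rewrite heightFrom-++ (+ 0) P (D ∷ []) | hP = refl
    downs : d₀ (+ 0) (P ++ D ∷ []) + d₀ (+ 0) (D ∷ mirror (dyck v) ++ Q) ≡ touchD₀ (+ 0) (P ++ D ∷ [])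
    downs rewrite countStart-++ D (+ 0) (+ 0) P (D ∷ []) | touchCount-++ D (+ 0) (+ 0) P (D ∷ []) | hP
                | countStart-++ D (+ 0) ℤ.-1ℤ (mirror (dyck v)) Q | countStart-mirror-dyck-below D (+ 0) v ℤ.-1ℤ ℤ.-<+
                | heightFrom-mirror-dyck v ℤ.-1ℤ
                = +-slide-suc (d₀ (+ 0) P) (d₀ ℤ.-1ℤ Q) (touchD₀ (+ 0) P) 0 dP
    ups : u₁ (+ 0) (P ++ D ∷ []) + u₁ (+ 2) (D ∷ mirror (dyck v) ++ Q) ≡ touchU₁ (+ 0) (P ++ D ∷ [])
    ups rewrite countStart-++ U (+ 1) (+ 0) P (D ∷ []) | touchCount-++ U (+ 1) (+ 0) P (D ∷ [])
              | countStart-++ U (+ 1) (+ 1) (mirror (dyck v)) Q | countStart-U-mirror-dyck-base v (+ 1) | heightFrom-mirror-dyck v (+ 1)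
              = +-slide (u₁ (+ 0) P) (u₁ (+ 1) Q) (touchU₁ (+ 0) P) 0 uP

reversed-skipG : ∀ {P Q} u v → ReversedFrame P Q →
  d₀ (+ 0) ((P ++ D ∷ mirror (dyck u)) ++ D ∷ (mirror (dyck v) ++ Q)) ≡ touchD₀ (+ 0) (P ++ D ∷ mirror (dyck u))
reversed-skipG {P} {Q} u v (reversedFrame hP dP _)
  rewrite ++-assoc P (D ∷ mirror (dyck u)) (D ∷ (mirror (dyck v) ++ Q))
        | countStart-++ D (+ 0) (+ 0) P (D ∷ mirror (dyck u) ++ D ∷ (mirror (dyck v) ++ Q)) | touchCount-++ D (+ 0) (+ 0) P (D ∷ mirror (dyck u)) | hP
        | countStart-++ D (+ 0) (+ 0) (mirror (dyck u)) (D ∷ (mirror (dyck v) ++ Q)) | heightFrom-mirror-dyck u (+ 0)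
        | countStart≡touchCount-D-mirror-dyck-base u (+ 0)
        | countStart-++ D (+ 0) ℤ.-1ℤ (mirror (dyck v)) Q | countStart-mirror-dyck-below D (+ 0) v ℤ.-1ℤ ℤ.-<+ | heightFrom-mirror-dyck v ℤ.-1ℤ
        = +-rearrange (d₀ (+ 0) P) (d₀ ℤ.-1ℤ Q) (touchD₀ (+ 0) P) (touchD₀ (+ 0) (mirror (dyck u))) dP
  where
    +-rearrange : ∀ a b t x → a + b ≡ t → a + (x + suc b) ≡ t + suc x
    +-rearrange a b t x e = trans (+-comm₃ a b x) (cong (_+ suc x) e)
      where
        +-comm₃ : ∀ a b x → a + (x + suc b) ≡ a + b + suc x
        +-comm₃ = solve-∀

mutual
  πFromG : ℕ → Path → List ℕ
  πFromG zero    X = []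
  πFromG (suc n) X = posG X ∷ πFromH n (gMap X)

  πFromH : ℕ → Path → List ℕ
  πFromH zero    X = []
  πFromH (suc n) X = posH X ∷ πFromG n (hMap X)

shift : ℕ → List ℕ → List ℕ
shift k = map (λ x → k + x)

mutual
  normalSeq : Tree → List ℕ
  normalSeq leaf = []
  normalSeq (node u v) = (2 + size u) ∷ shift 1 (reversedSeq u) ++ 1 ∷ shift (2 + size u) (normalSeq v)

  reversedSeq : Tree → List ℕ
  reversedSeq leaf = []
  reversedSeq (node u v) = shift (2 + size u) (reversedSeq v) ++ 1 ∷ shift 1 (normalSeq u) ++ (2 + size u) ∷ []

shift-shift : ∀ m n xs → shift m (shift n xs) ≡ shift (m + n) xs
shift-shift m n xs = trans (sym (map-∘ xs)) (map-cong (λ x → sym (NP.+-assoc m n x)) xs)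

shift-normalSeq-node : ∀ n u v rest → shift n (normalSeq (node u v)) ++ rest ≡
  (n + (2 + size u)) ∷ shift (n + 1) (reversedSeq u) ++ (n + 1) ∷ shift (n + (2 + size u)) (normalSeq v) ++ rest
shift-normalSeq-node n u v rest = cong ((n + (2 + size u)) ∷_) (begin
  shift n (shift 1 (reversedSeq u) ++ 1 ∷ shift (2 + size u) (normalSeq v)) ++ rest
    ≡⟨ cong (_++ rest) (map-++ (λ x → n + x) (shift 1 (reversedSeq u)) _) ⟩
  (shift n (shift 1 (reversedSeq u)) ++ (n + 1) ∷ shift n (shift (2 + size u) (normalSeq v))) ++ rest
    ≡⟨ ++-assoc (shift n (shift 1 (reversedSeq u))) _ rest ⟩
  shift n (shift 1 (reversedSeq u)) ++ (n + 1) ∷ shift n (shift (2 + size u) (normalSeq v)) ++ rest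
    ≡⟨ cong₂ (λ x y → x ++ (n + 1) ∷ y ++ rest) (shift-shift n 1 (reversedSeq u)) (shift-shift n (2 + size u) (normalSeq v)) ⟩
  shift (n + 1) (reversedSeq u) ++ (n + 1) ∷ shift (n + (2 + size u)) (normalSeq v) ++ rest ∎)
  where open ≡-Reasoning

shift-reversedSeq-node : ∀ n u v rest → shift n (reversedSeq (node u v)) ++ rest ≡
  shift (n + (2 + size u)) (reversedSeq v) ++ (n + 1) ∷ shift (n + 1) (normalSeq u) ++ (n + (2 + size u)) ∷ rest
shift-reversedSeq-node n u v rest = begin
  shift n (shift (2 + size u) (reversedSeq v) ++ 1 ∷ shift 1 (normalSeq u) ++ (2 + size u) ∷ []) ++ rest
    ≡⟨ cong (_++ rest) (map-++ (λ x → n + x) (shift (2 + size u) (reversedSeq v)) _) ⟩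
  (shift n (shift (2 + size u) (reversedSeq v)) ++ (n + 1) ∷ shift n (shift 1 (normalSeq u) ++ (2 + size u) ∷ [])) ++ rest
    ≡⟨ ++-assoc (shift n (shift (2 + size u) (reversedSeq v))) _ rest ⟩
  shift n (shift (2 + size u) (reversedSeq v)) ++ (n + 1) ∷ shift n (shift 1 (normalSeq u) ++ (2 + size u) ∷ []) ++ rest
    ≡⟨ cong (λ z → shift n (shift (2 + size u) (reversedSeq v)) ++ (n + 1) ∷ z ++ rest) (map-++ (λ x → n + x) (shift 1 (normalSeq u)) _) ⟩
  shift n (shift (2 + size u) (reversedSeq v)) ++ (n + 1) ∷ (shift n (shift 1 (normalSeq u)) ++ (n + (2 + size u)) ∷ []) ++ rest
    ≡⟨ cong (λ z → shift n (shift (2 + size u) (reversedSeq v)) ++ (n + 1) ∷ z) (++-assoc (shift n (shift 1 (normalSeq u))) _ rest) ⟩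
  shift n (shift (2 + size u) (reversedSeq v)) ++ (n + 1) ∷ shift n (shift 1 (normalSeq u)) ++ (n + (2 + size u)) ∷ rest
    ≡⟨ cong₂ (λ x y → x ++ (n + 1) ∷ y ++ (n + (2 + size u)) ∷ rest) (shift-shift n (2 + size u) (reversedSeq v)) (shift-shift n 1 (normalSeq u)) ⟩
  shift (n + (2 + size u)) (reversedSeq v) ++ (n + 1) ∷ shift (n + 1) (normalSeq u) ++ (n + (2 + size u)) ∷ rest ∎
  where open ≡-Reasoning

normal-gStep : ∀ {P Q} u v → NormalFrame P Q →
  (posG (P ++ dyck (node u v) ++ Q) ≡ length P + (2 + size u))
  × (gMap (P ++ dyck (node u v) ++ Q) ≡ (P ++ U ∷ []) ++ dyck u ++ U ∷ dyck v ++ Q)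
normal-gStep {P} {Q} u v F@(normalFrame hP _ _) =
  trans (cong posG split) (trans (proj₁ hit) offset) , trans (cong gMap split) (trans (proj₂ hit) regroup)
  where
    open ≡-Reasoning
    A = P ++ U ∷ dyck u
    split : P ++ dyck (node u v) ++ Q ≡ A ++ D ∷ dyck v ++ Q
    split = begin
      P ++ U ∷ (dyck u ++ D ∷ dyck v) ++ Q ≡⟨ cong (λ z → P ++ U ∷ z) (++-assoc (dyck u) (D ∷ dyck v) Q) ⟩
      P ++ U ∷ dyck u ++ D ∷ dyck v ++ Q   ≡⟨ sym (++-assoc P (U ∷ dyck u) _) ⟩
      A ++ D ∷ dyck v ++ Q ∎
    height : heightFrom (+ 0) A ≡ + 1
    height rewrite heightFrom-++ (+ 0) P (U ∷ dyck u) | hP = heightFrom-dyck u (+ 1)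
    hit = g-after A (dyck v ++ Q) (trans (cong (d₀ (+ 0)) (sym split)) (normal-skipG u v F)) (subst (Touches D (+ 0)) (sym height) refl)
    offset : suc (length A) ≡ length P + (2 + size u)
    offset = trans (suc-length-++-∷ P U (dyck u)) (cong (λ n → length P + (2 + n)) (length-dyck u))
    regroup : A ++ U ∷ dyck v ++ Q ≡ (P ++ U ∷ []) ++ dyck u ++ U ∷ dyck v ++ Q
    regroup = trans (++-assoc P (U ∷ dyck u) _) (sym (++-assoc P (U ∷ []) _))

normal-hStep : ∀ {P Q} u v → NormalFrame P Q →
  (posH ((P ++ U ∷ []) ++ mirror (dyck u) ++ U ∷ dyck v ++ Q) ≡ length P + 1)
  × (hMap ((P ++ U ∷ []) ++ mirror (dyck u) ++ U ∷ dyck v ++ Q) ≡ (P ++ D ∷ mirror (dyck u) ++ U ∷ []) ++ dyck v ++ Q)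
normal-hStep {P} {Q} u v F@(normalFrame hP _ _) =
  trans (cong posH split) (trans (proj₁ hit) (NP.+-comm 1 (length P))) , trans (cong hMap split) (trans (proj₂ hit) regroup)
  where
    B = mirror (dyck u) ++ U ∷ dyck v ++ Q
    split : (P ++ U ∷ []) ++ B ≡ P ++ U ∷ B
    split = ++-assoc P (U ∷ []) B
    hit = h-after P B (normal-skipH u v F) (subst (Touches U (+ 1)) (sym hP) refl)
    regroup : P ++ D ∷ B ≡ (P ++ D ∷ mirror (dyck u) ++ U ∷ []) ++ dyck v ++ Q
    regroup = sym (trans (++-assoc P _ _) (cong (λ z → P ++ D ∷ z) (++-assoc (mirror (dyck u)) (U ∷ []) _)))

reversed-hStep : ∀ {P Q} u v → ReversedFrame P Q →
  (posH ((P ++ U ∷ dyck u ++ D ∷ []) ++ mirror (dyck v) ++ Q) ≡ length P + 1)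
  × (hMap ((P ++ U ∷ dyck u ++ D ∷ []) ++ mirror (dyck v) ++ Q) ≡ (P ++ D ∷ []) ++ dyck u ++ D ∷ mirror (dyck v) ++ Q)
reversed-hStep {P} {Q} u v F@(reversedFrame hP _ _) =
  trans (cong posH split) (trans (proj₁ hit) (NP.+-comm 1 (length P))) , trans (cong hMap split) (trans (proj₂ hit) regroup)
  where
    B = dyck u ++ D ∷ mirror (dyck v) ++ Q
    split : (P ++ U ∷ dyck u ++ D ∷ []) ++ mirror (dyck v) ++ Q ≡ P ++ U ∷ B
    split = trans (++-assoc P (U ∷ dyck u ++ D ∷ []) _) (cong (λ z → P ++ U ∷ z) (++-assoc (dyck u) (D ∷ []) _))
    hit = h-after P B (reversed-skipH u v F) (subst (Touches U (+ 1)) (sym hP) refl)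
    regroup : P ++ D ∷ B ≡ (P ++ D ∷ []) ++ B
    regroup = sym (++-assoc P (D ∷ []) B)

reversed-gStep : ∀ {P Q} u v → ReversedFrame P Q →
  (posG ((P ++ D ∷ []) ++ mirror (dyck u) ++ D ∷ mirror (dyck v) ++ Q) ≡ length P + (2 + size u))
  × (gMap ((P ++ D ∷ []) ++ mirror (dyck u) ++ D ∷ mirror (dyck v) ++ Q) ≡ P ++ mirror (dyck (node u v)) ++ Q)
reversed-gStep {P} {Q} u v F@(reversedFrame hP _ _) =
  trans (cong posG split) (trans (proj₁ hit) offset) , trans (cong gMap split) (trans (proj₂ hit) regroup)
  where
    open ≡-Reasoning
    A = P ++ D ∷ mirror (dyck u)
    split : (P ++ D ∷ []) ++ mirror (dyck u) ++ D ∷ mirror (dyck v) ++ Q ≡ A ++ D ∷ mirror (dyck v) ++ Q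
    split = trans (++-assoc P (D ∷ []) _) (sym (++-assoc P (D ∷ mirror (dyck u)) _))
    height : heightFrom (+ 0) A ≡ + 0
    height rewrite heightFrom-++ (+ 0) P (D ∷ mirror (dyck u)) | hP = heightFrom-mirror-dyck u (+ 0)
    hit = g-after A (mirror (dyck v) ++ Q) (reversed-skipG u v F) (subst (Touches D (+ 0)) (sym height) refl)
    offset : suc (length A) ≡ length P + (2 + size u)
    offset = trans (suc-length-++-∷ P D (mirror (dyck u))) (cong (λ n → length P + (2 + n)) (length-mirror-dyck u))
    regroup : A ++ U ∷ mirror (dyck v) ++ Q ≡ P ++ mirror (dyck (node u v)) ++ Q
    regroup = begin
      (P ++ D ∷ mirror (dyck u)) ++ U ∷ mirror (dyck v) ++ Q ≡⟨ ++-assoc P _ _ ⟩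
      P ++ D ∷ mirror (dyck u) ++ U ∷ mirror (dyck v) ++ Q   ≡⟨ cong (λ z → P ++ D ∷ z) (sym (++-assoc (mirror (dyck u)) (U ∷ mirror (dyck v)) Q)) ⟩
      P ++ (D ∷ mirror (dyck u) ++ U ∷ mirror (dyck v)) ++ Q ≡⟨ cong (λ z → P ++ z ++ Q) (sym (mirror-dyck-node u v)) ⟩
      P ++ mirror (dyck (node u v)) ++ Q ∎

mutual
  πFromG-normal : ∀ t {P Q} k → NormalFrame P Q →
    πFromG (size t + k) (P ++ dyck t ++ Q) ≡ shift (length P) (normalSeq t) ++ πFromG k (P ++ mirror (dyck t) ++ Q)
  πFromG-normal leaf k F = refl
  πFromG-normal (node u v) {P} {Q} k F = begin
    πFromG (size (node u v) + k) (P ++ dyck (node u v) ++ Q)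
      ≡⟨ cong (λ m → πFromG (suc m) (P ++ dyck (node u v) ++ Q)) (NP.+-assoc (size u) (suc (size v)) k) ⟩
    posG (P ++ dyck (node u v) ++ Q) ∷ πFromH (size u + suc (size v + k)) (gMap (P ++ dyck (node u v) ++ Q))
      ≡⟨ cong₂ _∷_ (proj₁ g) (cong (πFromH _) (proj₂ g)) ⟩
    n + b ∷ πFromH (size u + suc (size v + k)) ((P ++ U ∷ []) ++ dyck u ++ U ∷ dyck v ++ Q)
      ≡⟨ cong (n + b ∷_) (πFromH-reversed u (suc (size v + k)) (normal→reversed v F)) ⟩
    n + b ∷ shift (length (P ++ U ∷ [])) (reversedSeq u) ++ posH Y ∷ πFromG (size v + k) (hMap Y)
      ≡⟨ cong (λ z → n + b ∷ shift (length (P ++ U ∷ [])) (reversedSeq u) ++ z) (cong₂ _∷_ (proj₁ h) (cong (πFromG _) (proj₂ h))) ⟩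
    n + b ∷ shift (length (P ++ U ∷ [])) (reversedSeq u) ++ n + 1 ∷ πFromG (size v + k) (P' ++ dyck v ++ Q)
      ≡⟨ cong (λ z → n + b ∷ shift (length (P ++ U ∷ [])) (reversedSeq u) ++ n + 1 ∷ z) (πFromG-normal v k (normal-next u F)) ⟩
    n + b ∷ shift (length (P ++ U ∷ [])) (reversedSeq u) ++ n + 1 ∷ shift (length P') (normalSeq v) ++ πFromG k (P' ++ mirror (dyck v) ++ Q)
      ≡⟨ cong₂ (λ x y → n + b ∷ shift x (reversedSeq u) ++ n + 1 ∷ shift y (normalSeq v) ++ πFromG k (P' ++ mirror (dyck v) ++ Q))
               (length-++ P) (trans (length-++-bracket P D U (mirror (dyck u))) (cong (λ m → n + (2 + m)) (length-mirror-dyck u))) ⟩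
    n + b ∷ shift (n + 1) (reversedSeq u) ++ n + 1 ∷ shift (n + b) (normalSeq v) ++ πFromG k (P' ++ mirror (dyck v) ++ Q)
      ≡⟨ cong (λ z → n + b ∷ shift (n + 1) (reversedSeq u) ++ n + 1 ∷ shift (n + b) (normalSeq v) ++ πFromG k z) (++-mirror-dyck-node P u v Q) ⟩
    n + b ∷ shift (n + 1) (reversedSeq u) ++ n + 1 ∷ shift (n + b) (normalSeq v) ++ πFromG k (P ++ mirror (dyck (node u v)) ++ Q)
      ≡⟨ sym (shift-normalSeq-node n u v _) ⟩
    shift n (normalSeq (node u v)) ++ πFromG k (P ++ mirror (dyck (node u v)) ++ Q) ∎
    where
      open ≡-Reasoning
      n = length P
      b = 2 + size u
      Y = (P ++ U ∷ []) ++ mirror (dyck u) ++ U ∷ dyck v ++ Q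
      P' = P ++ D ∷ mirror (dyck u) ++ U ∷ []
      g = normal-gStep u v F
      h = normal-hStep u v F

  πFromH-reversed : ∀ t {P Q} k → ReversedFrame P Q →
    πFromH (size t + k) (P ++ dyck t ++ Q) ≡ shift (length P) (reversedSeq t) ++ πFromH k (P ++ mirror (dyck t) ++ Q)
  πFromH-reversed leaf k F = refl
  πFromH-reversed (node u v) {P} {Q} k F = begin
    πFromH (size (node u v) + k) (P ++ dyck (node u v) ++ Q)
      ≡⟨ cong₂ πFromH (+-rearrange (size u) (size v) k) (++-dyck-node P u v Q) ⟩
    πFromH (size v + suc (size u + suc k)) (P₁ ++ dyck v ++ Q)
      ≡⟨ πFromH-reversed v (suc (size u + suc k)) (reversed-next u F) ⟩
    shift (length P₁) (reversedSeq v) ++ posH Y ∷ πFromG (size u + suc k) (hMap Y)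
      ≡⟨ cong (λ z → shift (length P₁) (reversedSeq v) ++ z) (cong₂ _∷_ (proj₁ h) (cong (πFromG _) (proj₂ h))) ⟩
    shift (length P₁) (reversedSeq v) ++ n + 1 ∷ πFromG (size u + suc k) ((P ++ D ∷ []) ++ dyck u ++ D ∷ mirror (dyck v) ++ Q)
      ≡⟨ cong (λ z → shift (length P₁) (reversedSeq v) ++ n + 1 ∷ z) (πFromG-normal u (suc k) (reversed→normal v F)) ⟩
    shift (length P₁) (reversedSeq v) ++ n + 1 ∷ shift (length (P ++ D ∷ [])) (normalSeq u) ++ posG Z ∷ πFromH k (gMap Z)
      ≡⟨ cong (λ z → shift (length P₁) (reversedSeq v) ++ n + 1 ∷ shift (length (P ++ D ∷ [])) (normalSeq u) ++ z)
              (cong₂ _∷_ (proj₁ g) (cong (πFromH k) (proj₂ g))) ⟩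
    shift (length P₁) (reversedSeq v) ++ n + 1 ∷ shift (length (P ++ D ∷ [])) (normalSeq u) ++ n + b ∷ rest
      ≡⟨ cong₂ (λ x y → shift x (reversedSeq v) ++ n + 1 ∷ shift y (normalSeq u) ++ n + b ∷ rest)
               (trans (length-++-bracket P U D (dyck u)) (cong (λ m → n + (2 + m)) (length-dyck u))) (length-++ P) ⟩
    shift (n + b) (reversedSeq v) ++ n + 1 ∷ shift (n + 1) (normalSeq u) ++ n + b ∷ rest
      ≡⟨ sym (shift-reversedSeq-node n u v rest) ⟩
    shift n (reversedSeq (node u v)) ++ rest ∎
    where
      open ≡-Reasoning
      n = length P
      b = 2 + size u
      P₁ = P ++ U ∷ dyck u ++ D ∷ []
      Y = P₁ ++ mirror (dyck v) ++ Q
      Z = (P ++ D ∷ []) ++ mirror (dyck u) ++ D ∷ mirror (dyck v) ++ Q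
      rest = πFromH k (P ++ mirror (dyck (node u v)) ++ Q)
      h = reversed-hStep u v F
      g = reversed-gStep u v F
      +-rearrange : ∀ a c k → suc (a + suc c) + k ≡ c + suc (a + suc k)
      +-rearrange = solve-∀

nodes : Tree → ℕ
nodes leaf = 0
nodes (node u v) = suc (nodes u + nodes v)

size≡nodes+nodes : ∀ t → size t ≡ nodes t + nodes t
size≡nodes+nodes leaf = refl
size≡nodes+nodes (node u v) = cong suc (trans (cong₂ (λ a b → a + suc b) (size≡nodes+nodes u) (size≡nodes+nodes v)) (+-shuffle (nodes u) (nodes v)))
  where
    +-shuffle : ∀ a b → a + a + suc (b + b) ≡ a + b + suc (a + b)
    +-shuffle = solve-∀

πIter≡πFromG : ∀ m x → πIter m x ≡ πFromG (m + m) x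
πIter≡πFromG zero x = refl
πIter≡πFromG (suc m) x rewrite NP.+-suc m m = cong (λ z → posG x ∷ posH (gMap x) ∷ z) (πIter≡πFromG m (hMap (gMap x)))

πPerm-dyck : ∀ t → πPerm (dyck t) ≡ normalSeq t
πPerm-dyck t = begin
  πIter ⌊ length (dyck t) /2⌋ (dyck t)   ≡⟨ cong (λ n → πIter ⌊ n /2⌋ (dyck t)) (trans (length-dyck t) (size≡nodes+nodes t)) ⟩
  πIter ⌊ nodes t + nodes t /2⌋ (dyck t) ≡⟨ cong (λ m → πIter m (dyck t)) (sym (NP.n≡⌊n+n/2⌋ (nodes t))) ⟩
  πIter (nodes t) (dyck t)               ≡⟨ πIter≡πFromG (nodes t) (dyck t) ⟩
  πFromG (nodes t + nodes t) (dyck t)    ≡⟨ cong₂ πFromG (trans (sym (size≡nodes+nodes t)) (sym (NP.+-identityʳ (size t)))) (sym (++-identityʳ (dyck t))) ⟩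
  πFromG (size t + 0) ([] ++ dyck t ++ []) ≡⟨ πFromG-normal t {[]} {[]} 0 (normalFrame refl refl refl) ⟩
  shift 0 (normalSeq t) ++ []            ≡⟨ trans (++-identityʳ _) (map-id (normalSeq t)) ⟩
  normalSeq t ∎
  where open ≡-Reasoning

Position : ℕ → ℕ → Set
Position n i = 1 ≤ i × i ≤ n

all-position-shift : ∀ k {n m} xs → k + n ≤ m → All (Position n) xs → All (Position m) (shift k xs)
all-position-shift k {n} xs k+n≤m ps =
  map⁺ (All.map (λ {i} (1≤i , i≤n) → NP.≤-trans 1≤i (NP.m≤n+m i k) , NP.≤-trans (NP.+-monoʳ-≤ k i≤n) k+n≤m) ps)

2+size≤size-node : ∀ u v → 2 + size u ≤ size (node u v)
2+size≤size-node u v = subst (2 + size u ≤_) (sym (size-node u v)) (NP.m≤m+n (2 + size u) (size v))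

mutual
  all-position-normalSeq : ∀ t → All (Position (size t)) (normalSeq t)
  all-position-normalSeq leaf = []
  all-position-normalSeq (node u v) =
    (s≤s z≤n , 2+size≤size-node u v)
    ∷ ++⁺ (all-position-shift 1 (reversedSeq u) (s≤s (NP.m≤m+n (size u) (suc (size v)))) (all-position-reversedSeq u))
          ((s≤s z≤n , s≤s z≤n)
           ∷ all-position-shift (2 + size u) (normalSeq v) (NP.≤-reflexive (sym (size-node u v))) (all-position-normalSeq v))

  all-position-reversedSeq : ∀ t → All (Position (size t)) (reversedSeq t)
  all-position-reversedSeq leaf = []
  all-position-reversedSeq (node u v) =
    ++⁺ (all-position-shift (2 + size u) (reversedSeq v) (NP.≤-reflexive (sym (size-node u v))) (all-position-reversedSeq v))
        ((s≤s z≤n , s≤s z≤n)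
         ∷ ++⁺ (all-position-shift 1 (normalSeq u) (s≤s (NP.m≤m+n (size u) (suc (size v)))) (all-position-normalSeq u))
               ((s≤s z≤n , 2+size≤size-node u v) ∷ []))

-- Concatenation and reversal of trees

infixr 5 _++ₜ_

_++ₜ_ : Tree → Tree → Tree
leaf ++ₜ r = r
node u v ++ₜ r = node u (v ++ₜ r)

dyck-++ₜ : ∀ t r → dyck (t ++ₜ r) ≡ dyck t ++ dyck r
dyck-++ₜ leaf r = refl
dyck-++ₜ (node u v) r = cong (U ∷_) (trans (cong (λ z → dyck u ++ D ∷ z) (dyck-++ₜ v r)) (sym (++-assoc (dyck u) (D ∷ dyck v) (dyck r))))

shift-size-node : ∀ u v xs → shift (2 + size u) (shift (size v) xs) ≡ shift (size (node u v)) xs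
shift-size-node u v xs = trans (shift-shift (2 + size u) (size v) xs) (cong (λ k → shift k xs) (sym (size-node u v)))

normalSeq-++ₜ : ∀ t r → normalSeq (t ++ₜ r) ≡ normalSeq t ++ shift (size t) (normalSeq r)
normalSeq-++ₜ leaf r = sym (map-id (normalSeq r))
normalSeq-++ₜ (node u v) r = begin
  2 + size u ∷ shift 1 (reversedSeq u) ++ 1 ∷ shift (2 + size u) (normalSeq (v ++ₜ r))
    ≡⟨ cong (λ z → 2 + size u ∷ shift 1 (reversedSeq u) ++ 1 ∷ shift (2 + size u) z) (normalSeq-++ₜ v r) ⟩
  2 + size u ∷ shift 1 (reversedSeq u) ++ 1 ∷ shift (2 + size u) (normalSeq v ++ shift (size v) (normalSeq r))
    ≡⟨ cong (λ z → 2 + size u ∷ shift 1 (reversedSeq u) ++ 1 ∷ z) (map-++ _ (normalSeq v) _) ⟩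
  2 + size u ∷ shift 1 (reversedSeq u) ++ 1 ∷ shift (2 + size u) (normalSeq v) ++ shift (2 + size u) (shift (size v) (normalSeq r))
    ≡⟨ cong (λ z → 2 + size u ∷ shift 1 (reversedSeq u) ++ 1 ∷ shift (2 + size u) (normalSeq v) ++ z) (shift-size-node u v (normalSeq r)) ⟩
  2 + size u ∷ shift 1 (reversedSeq u) ++ 1 ∷ shift (2 + size u) (normalSeq v) ++ shift (size (node u v)) (normalSeq r)
    ≡⟨ cong (2 + size u ∷_) (sym (++-assoc (shift 1 (reversedSeq u)) _ _)) ⟩
  normalSeq (node u v) ++ shift (size (node u v)) (normalSeq r) ∎
  where open ≡-Reasoning

reversedSeq-++ₜ : ∀ t r → reversedSeq (t ++ₜ r) ≡ shift (size t) (reversedSeq r) ++ reversedSeq t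
reversedSeq-++ₜ leaf r = sym (trans (++-identityʳ _) (map-id (reversedSeq r)))
reversedSeq-++ₜ (node u v) r = begin
  shift (2 + size u) (reversedSeq (v ++ₜ r)) ++ tail
    ≡⟨ cong (λ z → shift (2 + size u) z ++ tail) (reversedSeq-++ₜ v r) ⟩
  shift (2 + size u) (shift (size v) (reversedSeq r) ++ reversedSeq v) ++ tail
    ≡⟨ cong (_++ tail) (map-++ _ (shift (size v) (reversedSeq r)) (reversedSeq v)) ⟩
  (shift (2 + size u) (shift (size v) (reversedSeq r)) ++ shift (2 + size u) (reversedSeq v)) ++ tail
    ≡⟨ ++-assoc (shift (2 + size u) (shift (size v) (reversedSeq r))) _ tail ⟩
  shift (2 + size u) (shift (size v) (reversedSeq r)) ++ shift (2 + size u) (reversedSeq v) ++ tail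
    ≡⟨ cong (_++ shift (2 + size u) (reversedSeq v) ++ tail) (shift-size-node u v (reversedSeq r)) ⟩
  shift (size (node u v)) (reversedSeq r) ++ reversedSeq (node u v) ∎
  where
    open ≡-Reasoning
    tail = 1 ∷ shift 1 (normalSeq u) ++ (2 + size u) ∷ []

reverseₜ : Tree → Tree
reverseₜ leaf = leaf
reverseₜ (node u v) = reverseₜ v ++ₜ node (reverseₜ u) leaf

dyck-reverseₜ : ∀ t → dyck (reverseₜ t) ≡ revBar (dyck t)
dyck-reverseₜ leaf = refl
dyck-reverseₜ (node u v) = begin
  dyck (reverseₜ v ++ₜ node (reverseₜ u) leaf)            ≡⟨ dyck-++ₜ (reverseₜ v) _ ⟩
  dyck (reverseₜ v) ++ U ∷ dyck (reverseₜ u) ++ D ∷ []    ≡⟨ cong₂ (λ x y → x ++ U ∷ y ++ D ∷ []) (dyck-reverseₜ v) (dyck-reverseₜ u) ⟩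
  revBar (dyck v) ++ U ∷ revBar (dyck u) ++ D ∷ []        ≡⟨ sym (revBar-dyck-node u v) ⟩
  revBar (dyck (node u v)) ∎
  where open ≡-Reasoning

size-reverseₜ : ∀ t → size (reverseₜ t) ≡ size t
size-reverseₜ t = trans (sym (length-dyck (reverseₜ t))) (trans (cong length (dyck-reverseₜ t)) (trans (length-map flipStep (reverse (dyck t))) (trans (length-reverse (dyck t)) (length-dyck t))))

reflect : ℕ → List ℕ → List ℕ
reflect n = map (λ i → suc n ∸ i)

reflect-shift : ∀ b m xs → reflect (b + m) (shift b xs) ≡ reflect m xs
reflect-shift b m xs = trans (sym (map-∘ xs))
  (map-cong (λ i → trans (cong (_∸ (b + i)) (sym (NP.+-suc b m))) (NP.[m+n]∸[m+o]≡n∸o b (suc m) i)) xs)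

reflect-shift-1 : ∀ m k xs → All (Position m) xs → reflect (suc (m + suc k)) (shift 1 xs) ≡ shift k (shift 1 (reflect m xs))
reflect-shift-1 m k xs ps = begin
  reflect (suc (m + suc k)) (shift 1 xs)       ≡⟨ sym (map-∘ xs) ⟩
  map (λ i → suc (m + suc k) ∸ i) xs          ≡⟨ map-cong-local (All.map (λ {i} (_ , i≤m) → pointwise i i≤m) ps) ⟩
  map (λ i → k + suc (suc m ∸ i)) xs          ≡⟨ map-∘ xs ⟩
  shift k (map (λ i → suc (suc m ∸ i)) xs)    ≡⟨ cong (shift k) (map-∘ xs) ⟩
  shift k (shift 1 (reflect m xs)) ∎
  where
    open ≡-Reasoning
    +-rearrange : ∀ m k → suc (m + suc k) ≡ k + suc (suc m)
    +-rearrange = solve-∀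
    pointwise : ∀ i → i ≤ m → suc (m + suc k) ∸ i ≡ k + suc (suc m ∸ i)
    pointwise i i≤m = begin
      suc (m + suc k) ∸ i   ≡⟨ cong (_∸ i) (+-rearrange m k) ⟩
      k + suc (suc m) ∸ i   ≡⟨ NP.+-∸-assoc k (NP.m≤n⇒m≤1+n (NP.m≤n⇒m≤1+n i≤m)) ⟩
      k + (suc (suc m) ∸ i) ≡⟨ cong (λ z → k + z) (NP.+-∸-assoc 1 (NP.m≤n⇒m≤1+n i≤m)) ⟩
      k + suc (suc m ∸ i) ∎

reflect-shift-node : ∀ u v xs → reflect (size (node u v)) (shift (2 + size u) xs) ≡ reflect (size v) xs
reflect-shift-node u v xs = trans (cong (λ m → reflect m (shift (2 + size u) xs)) (size-node u v)) (reflect-shift (2 + size u) (size v) xs)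

reflect-node-1 : ∀ u v → suc (size (node u v)) ∸ 1 ≡ size v + (2 + size u)
reflect-node-1 u v = +-rearrange (size u) (size v)
  where
    +-rearrange : ∀ a c → suc (a + suc c) ≡ c + (2 + a)
    +-rearrange = solve-∀

reflect-node-b : ∀ u v → suc (size (node u v)) ∸ (2 + size u) ≡ size v + 1
reflect-node-b u v = trans (NP.m+n∸m≡n (size u) (suc (size v))) (NP.+-comm 1 (size v))

mutual
  normalSeq-reverseₜ : ∀ t → normalSeq (reverseₜ t) ≡ reflect (size t) (reversedSeq t)
  normalSeq-reverseₜ leaf = refl
  normalSeq-reverseₜ (node u v) = begin
    normalSeq (reverseₜ v ++ₜ node (reverseₜ u) leaf)
      ≡⟨ normalSeq-++ₜ (reverseₜ v) _ ⟩
    normalSeq (reverseₜ v) ++ shift (size (reverseₜ v)) (2 + size (reverseₜ u) ∷ shift 1 (reversedSeq (reverseₜ u)) ++ 1 ∷ [])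
      ≡⟨ cong₂ (λ x y → x ++ y) (normalSeq-reverseₜ v)
               (cong₂ (λ k m → shift k (2 + m ∷ shift 1 (reversedSeq (reverseₜ u)) ++ 1 ∷ [])) (size-reverseₜ v) (size-reverseₜ u)) ⟩
    reflect (size v) (reversedSeq v) ++ shift (size v) (2 + size u ∷ shift 1 (reversedSeq (reverseₜ u)) ++ 1 ∷ [])
      ≡⟨ cong (λ z → reflect (size v) (reversedSeq v) ++ size v + (2 + size u) ∷ z)
              (map-++ _ (shift 1 (reversedSeq (reverseₜ u))) (1 ∷ [])) ⟩
    reflect (size v) (reversedSeq v) ++ size v + (2 + size u) ∷ shift (size v) (shift 1 (reversedSeq (reverseₜ u))) ++ size v + 1 ∷ []
      ≡⟨ cong₂ (λ x y → x ++ size v + (2 + size u) ∷ y ++ size v + 1 ∷ [])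
               (sym (reflect-shift-node u v (reversedSeq v)))
               (trans (cong (λ z → shift (size v) (shift 1 z)) (reversedSeq-reverseₜ u)) (sym (reflect-shift-1 (size u) (size v) (normalSeq u) (all-position-normalSeq u)))) ⟩
    reflect n (shift b (reversedSeq v)) ++ size v + (2 + size u) ∷ reflect n (shift 1 (normalSeq u)) ++ size v + 1 ∷ []
      ≡⟨ cong₂ (λ x y → reflect n (shift b (reversedSeq v)) ++ x ∷ reflect n (shift 1 (normalSeq u)) ++ y ∷ []) (sym (reflect-node-1 u v)) (sym (reflect-node-b u v)) ⟩
    reflect n (shift b (reversedSeq v)) ++ suc n ∸ 1 ∷ reflect n (shift 1 (normalSeq u)) ++ suc n ∸ b ∷ []
      ≡⟨ cong (λ z → reflect n (shift b (reversedSeq v)) ++ suc n ∸ 1 ∷ z) (sym (map-++ _ (shift 1 (normalSeq u)) (b ∷ []))) ⟩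
    reflect n (shift b (reversedSeq v)) ++ reflect n (1 ∷ shift 1 (normalSeq u) ++ b ∷ [])
      ≡⟨ sym (map-++ _ (shift b (reversedSeq v)) _) ⟩
    reflect n (reversedSeq (node u v)) ∎
    where
      open ≡-Reasoning
      n = size (node u v)
      b = 2 + size u

  reversedSeq-reverseₜ : ∀ t → reversedSeq (reverseₜ t) ≡ reflect (size t) (normalSeq t)
  reversedSeq-reverseₜ leaf = refl
  reversedSeq-reverseₜ (node u v) = begin
    reversedSeq (reverseₜ v ++ₜ node (reverseₜ u) leaf)
      ≡⟨ reversedSeq-++ₜ (reverseₜ v) _ ⟩
    shift (size (reverseₜ v)) (1 ∷ shift 1 (normalSeq (reverseₜ u)) ++ 2 + size (reverseₜ u) ∷ []) ++ reversedSeq (reverseₜ v)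
      ≡⟨ cong₂ (λ x y → x ++ y)
               (cong₂ (λ k m → shift k (1 ∷ shift 1 (normalSeq (reverseₜ u)) ++ 2 + m ∷ [])) (size-reverseₜ v) (size-reverseₜ u))
               (reversedSeq-reverseₜ v) ⟩
    shift (size v) (1 ∷ shift 1 (normalSeq (reverseₜ u)) ++ 2 + size u ∷ []) ++ reflect (size v) (normalSeq v)
      ≡⟨ cong (λ z → size v + 1 ∷ z ++ reflect (size v) (normalSeq v)) (map-++ _ (shift 1 (normalSeq (reverseₜ u))) _) ⟩
    size v + 1 ∷ (shift (size v) (shift 1 (normalSeq (reverseₜ u))) ++ size v + (2 + size u) ∷ []) ++ reflect (size v) (normalSeq v)
      ≡⟨ cong (size v + 1 ∷_) (++-assoc (shift (size v) (shift 1 (normalSeq (reverseₜ u)))) _ _) ⟩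
    size v + 1 ∷ shift (size v) (shift 1 (normalSeq (reverseₜ u))) ++ size v + (2 + size u) ∷ reflect (size v) (normalSeq v)
      ≡⟨ cong₂ (λ x y → size v + 1 ∷ x ++ size v + (2 + size u) ∷ y)
               (trans (cong (λ z → shift (size v) (shift 1 z)) (normalSeq-reverseₜ u)) (sym (reflect-shift-1 (size u) (size v) (reversedSeq u) (all-position-reversedSeq u))))
               (sym (reflect-shift-node u v (normalSeq v))) ⟩
    size v + 1 ∷ reflect n (shift 1 (reversedSeq u)) ++ size v + (2 + size u) ∷ reflect n (shift b (normalSeq v))
      ≡⟨ cong₂ (λ x y → x ∷ reflect n (shift 1 (reversedSeq u)) ++ y ∷ reflect n (shift b (normalSeq v))) (sym (reflect-node-b u v)) (sym (reflect-node-1 u v)) ⟩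
    reflect n (b ∷ shift 1 (reversedSeq u)) ++ reflect n (1 ∷ shift b (normalSeq v))
      ≡⟨ sym (map-++ _ (b ∷ shift 1 (reversedSeq u)) _) ⟩
    reflect n (normalSeq (node u v)) ∎
    where
      open ≡-Reasoning
      n = size (node u v)
      b = 2 + size u

πPerm-revBar-dyck : ∀ t → πPerm (revBar (dyck t)) ≡ reflect (size t) (reversedSeq t)
πPerm-revBar-dyck t = trans (cong πPerm (sym (dyck-reverseₜ t))) (trans (πPerm-dyck (reverseₜ t)) (normalSeq-reverseₜ t))

reflect-reflect : ∀ n xs → All (Position n) xs → reflect n (reflect n xs) ≡ xs
reflect-reflect n xs ps = trans (sym (map-∘ xs))
  (trans (map-cong-local (All.map (λ (_ , i≤n) → NP.m∸[m∸n]≡n (NP.m≤n⇒m≤1+n i≤n)) ps)) (map-id xs))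

reflect-from-suc : ∀ n xs → All (Position n) xs → map (λ i → (n + 2) ∸ i) (reflect n xs) ≡ shift 1 xs
reflect-from-suc n xs ps = trans (sym (map-∘ xs)) (map-cong-local (All.map (λ {i} (_ , i≤n) → pointwise i i≤n) ps))
  where
    open ≡-Reasoning
    pointwise : ∀ i → i ≤ n → (n + 2) ∸ (suc n ∸ i) ≡ suc i
    pointwise i i≤n = begin
      (n + 2) ∸ (suc n ∸ i)         ≡⟨ cong (_∸ (suc n ∸ i)) (NP.+-comm n 2) ⟩
      suc (suc n) ∸ (suc n ∸ i)     ≡⟨ NP.+-∸-assoc 1 (NP.m∸n≤m (suc n) i) ⟩
      suc (suc n ∸ (suc n ∸ i))     ≡⟨ cong suc (NP.m∸[m∸n]≡n (NP.m≤n⇒m≤1+n i≤n)) ⟩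
      suc i ∎

firstReturn-dyck-above : ∀ t h i r → + 0 ℤ.< h → firstReturn h i (dyck t ++ r) ≡ firstReturn h (i + size t) r
firstReturn-dyck-above leaf h i r 0<h = cong (λ j → firstReturn h j r) (sym (NP.+-identityʳ i))
firstReturn-dyck-above (node u v) h i r 0<h = begin
  firstReturn (move U h) (suc i) ((dyck u ++ D ∷ dyck v) ++ r)   ≡⟨ cong (firstReturn (move U h) (suc i)) (++-assoc (dyck u) (D ∷ dyck v) r) ⟩
  firstReturn (move U h) (suc i) (dyck u ++ D ∷ dyck v ++ r)     ≡⟨ firstReturn-dyck-above u (move U h) (suc i) _ (ZP.<-trans 0<h (<-move-U h)) ⟩
  firstReturn (move U h) (suc i + size u) (D ∷ dyck v ++ r)      ≡⟨ firstReturn-D-off {move U h} (λ e → ≢-sym (ZP.<⇒≢ 0<h) (trans (sym (move-D-U h)) e)) ⟩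
  firstReturn (move D (move U h)) (suc (suc i + size u)) (dyck v ++ r) ≡⟨ cong (λ z → firstReturn z (suc (suc i + size u)) (dyck v ++ r)) (move-D-U h) ⟩
  firstReturn h (suc (suc i + size u)) (dyck v ++ r)             ≡⟨ firstReturn-dyck-above v h _ r 0<h ⟩
  firstReturn h (suc (suc i + size u) + size v) r                ≡⟨ cong (λ j → firstReturn h j r) (+-rearrange i (size u) (size v)) ⟩
  firstReturn h (i + size (node u v)) r ∎
  where
    open ≡-Reasoning
    +-rearrange : ∀ a b c → suc (suc a + b) + c ≡ a + suc (b + suc c)
    +-rearrange = solve-∀
    firstReturn-D-off : ∀ {h j ts} → move D h ≢ + 0 → firstReturn h j (D ∷ ts) ≡ firstReturn (move D h) (suc j) ts
    firstReturn-D-off ne rewrite ==ℤ-false ne = refl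

firstReturn-dyck-node : ∀ u v → firstReturn (+ 0) 0 (dyck (node u v)) ≡ 2 + size u
firstReturn-dyck-node u v = firstReturn-dyck-above u (+ 1) 1 (D ∷ dyck v) 0<1

canonU-dyck-node : ∀ u v → canonU (dyck (node u v)) ≡ dyck u
canonU-dyck-node u v rewrite firstReturn-dyck-node u v =
  trans (cong (λ n → take n (dyck u ++ D ∷ dyck v)) (sym (length-dyck u))) (take-length-++ (dyck u) _)

canonV-dyck-node : ∀ u v → canonV (dyck (node u v)) ≡ dyck v
canonV-dyck-node u v rewrite firstReturn-dyck-node u v =
  trans (cong (λ n → drop (suc n) (dyck u ++ D ∷ dyck v)) (sym (length-dyck u))) (drop-suc-length-++ (dyck u) D (dyck v))

CanonicalForm : Path → Set
CanonicalForm w =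
  πPerm w ≡ (length (canonU w) + 2)
            ∷ (map (λ t → (length (canonU w) + 2) ∸ t) (πPerm (revBar (canonU w)))
               ++ (1 ∷ map (λ t → (length (canonU w) + 2) + t) (πPerm (canonV w))))

canonicalForm-dyck-node : ∀ u v → CanonicalForm (dyck (node u v))
canonicalForm-dyck-node u v
  rewrite canonU-dyck-node u v | canonV-dyck-node u v | length-dyck u
        | πPerm-revBar-dyck u | πPerm-dyck v | πPerm-dyck (node u v) =
  cong₂ _∷_ (NP.+-comm 2 (size u))
    (cong₂ _++_ (sym (reflect-from-suc (size u) (reversedSeq u) (all-position-reversedSeq u)))
                (cong (1 ∷_) (cong (λ k → shift k (normalSeq v)) (NP.+-comm 2 (size u)))))

-- Parsing paths into trees

heightFrom-take-≥ : ∀ c h p j → downsBelow c h p ≡ 0 → c ℤ.≤ h → c ℤ.≤ heightFrom h (take j p)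
heightFrom-take-≥ c h p       zero    db c≤h = c≤h
heightFrom-take-≥ c h []      (suc j) db c≤h = c≤h
heightFrom-take-≥ c h (U ∷ p) (suc j) db c≤h = heightFrom-take-≥ c (move U h) p j db (ZP.≤-trans c≤h (ZP.<⇒≤ (<-move-U h)))
heightFrom-take-≥ c h (D ∷ p) (suc j) db c≤h with c ℤ.≟ h
... | yes refl = ⊥-elim (NP.1+n≢0 (trans (sym (downsBelow-D-on c p)) db))
... | no c≢h =
  heightFrom-take-≥ c (move D h) p j (trans (sym (downsBelow-D-above c h p c<h)) db)
                    (subst (c ℤ.≤_) (ZP.+-comm ℤ.-1ℤ h) (ZP.i<j⇒i≤pred[j] c<h))
  where
    c<h : c ℤ.< h
    c<h = ZP.≤∧≢⇒< c≤h c≢h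

downsBelow-dyck-above : ∀ c t h → c ℤ.< h → downsBelow c h (dyck t) ≡ 0
downsBelow-dyck-above c leaf h c<h = refl
downsBelow-dyck-above c (node u v) h c<h
  rewrite downsBelow-++ c (move U h) (dyck u) (D ∷ dyck v) | heightFrom-dyck u (move U h)
        | downsBelow-dyck-above c u (move U h) (ZP.<-trans c<h (<-move-U h))
        | downsBelow-D-above c (move U h) (dyck v) (ZP.<-trans c<h (<-move-U h)) | move-D-U h = downsBelow-dyck-above c v h c<h

downsBelow-dyck : ∀ t h → downsBelow h h (dyck t) ≡ 0
downsBelow-dyck leaf h = refl
downsBelow-dyck (node u v) h
  rewrite downsBelow-++ h (move U h) (dyck u) (D ∷ dyck v) | heightFrom-dyck u (move U h)
        | downsBelow-dyck-above h u (move U h) (<-move-U h)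
        | downsBelow-D-above h (move U h) (dyck v) (<-move-U h) | move-D-U h = downsBelow-dyck v h

-- A path from height c + n down to c that never steps below c consists of n + 1 Dyck blocks separated by
-- the down-steps that leave the levels c + n, …, c + 1 for the last time.
data Descent : ℕ → Set where
  block : Tree → Descent 0
  step  : ∀ {n} → Tree → Descent n → Descent (suc n)

descentPath : ∀ {n} → Descent n → Path
descentPath (block t) = dyck t
descentPath (step t L) = dyck t ++ D ∷ descentPath L

prependNode : ∀ {n} → Tree → Descent n → Descent n
prependNode u (block t) = block (node u t)
prependNode u (step t L) = step (node u t) L

descentPath-prependNode : ∀ {n} u (L : Descent n) → descentPath (prependNode u L) ≡ U ∷ dyck u ++ D ∷ descentPath L
descentPath-prependNode u (block t) = refl
descentPath-prependNode u (step t L) = cong (U ∷_) (++-assoc (dyck u) (D ∷ dyck t) (D ∷ descentPath L))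

descent : ∀ c p n → downsBelow c (c ℤ.+ + n) p ≡ 0 → heightFrom (c ℤ.+ + n) p ≡ c → Σ (Descent n) (λ L → descentPath L ≡ p)
descent c [] zero db hf = block leaf , refl
descent c [] (suc n) db hf = ⊥-elim (≢-sym (ZP.<⇒≢ (<-+-suc c n)) hf)
descent c (U ∷ p) n db hf with descent c p (suc n) (subst (λ z → downsBelow c z p ≡ 0) (move-U-+ c n) db) (subst (λ z → heightFrom z p ≡ c) (move-U-+ c n) hf)
... | step u L , e = prependNode u L , trans (descentPath-prependNode u L) (cong (U ∷_) e)
descent c (D ∷ p) zero db hf rewrite ZP.+-identityʳ c = ⊥-elim (NP.1+n≢0 (trans (sym (downsBelow-D-on c p)) db))
descent c (D ∷ p) (suc n) db hf with descent c p n db' (subst (λ z → heightFrom z p ≡ c) (move-D-+ c n) hf)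
  where
    db' : downsBelow c (c ℤ.+ + n) p ≡ 0
    db' = subst (λ z → downsBelow c z p ≡ 0) (move-D-+ c n) (trans (sym (downsBelow-D-above c _ p (<-+-suc c n))) db)
... | L , e = step leaf L , cong (D ∷_) e

dyckPath : ∀ c p → downsBelow c c p ≡ 0 → heightFrom c p ≡ c → Σ Tree (λ t → dyck t ≡ p)
dyckPath c p db hf with descent c p 0 (subst (λ h → downsBelow c h p ≡ 0) (sym (ZP.+-identityʳ c)) db) (subst (λ h → heightFrom h p ≡ c) (sym (ZP.+-identityʳ c)) hf)
... | block t , e = t , e

InD0⇒dyck : ∀ k xh → InD0 k xh → Σ Tree (λ T → dyck T ≡ xh)
InD0⇒dyck k xh (length≡ , countU≡ , downs≡) = dyckPath (+ 0) xh downs≡ returns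
  where
    countD≡ : countD xh ≡ k
    countD≡ = NP.+-cancelˡ-≡ k (countD xh) k (trans (cong (_+ countD xh) (sym countU≡)) (trans (sym (length≡countU+countD xh)) length≡))
    returns : heightFrom (+ 0) xh ≡ + 0
    returns = ∙-cancelʳ (+ k) _ _ (trans (cong (λ z → heightFrom (+ 0) xh ℤ.+ + z) (sym countD≡))
                                     (trans (heightFrom-+-countD (+ 0) xh) (cong (λ z → + 0 ℤ.+ + z) countU≡)))

-- The D after dyck u is the first step below the starting height, so it fixes u.
dyck-++-D-cancel : ∀ u u' {xs ys} → dyck u ++ D ∷ xs ≡ dyck u' ++ D ∷ ys → u ≡ u' × xs ≡ ys
dyck-++-D-cancel leaf leaf refl = refl , refl
dyck-++-D-cancel (node u₁ v₁) (node u₂ v₂) {xs} {ys} e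
  with dyck-++-D-cancel u₁ u₂ (trans (sym (++-assoc (dyck u₁) (D ∷ dyck v₁) _))
                                 (trans (∷-injectiveʳ e) (++-assoc (dyck u₂) (D ∷ dyck v₂) _)))
... | refl , e′ with dyck-++-D-cancel v₁ v₂ e′
...   | refl , refl = refl , refl

dyck-prefix : ∀ T t rest → dyck T ≡ dyck t ++ rest → ∃[ r ] T ≡ t ++ₜ r
dyck-prefix T leaf rest e = T , refl
dyck-prefix (node u′ v′) (node u v) rest e
  with dyck-++-D-cancel u′ u (trans (∷-injectiveʳ e) (++-assoc (dyck u) (D ∷ dyck v) rest))
... | refl , e′ with dyck-prefix v′ v rest e′
...   | r , refl = r , refl

-- Windows of a sequence

Inside Outside : ℕ → ℕ → ℕ → Set
Inside a n i = T (inRange a n i)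
Outside a n i = T (not (inRange a n i))

inside : ∀ {a n i} → a < i → i ≤ a + n → Inside a n i
inside a<i i≤a+n = Equivalence.from T-∧ (NP.<⇒<ᵇ a<i , NP.≤⇒≤ᵇ i≤a+n)

outside-≤ : ∀ {a n i} → i ≤ a → Outside a n i
outside-≤ {a} {n} {i} i≤a = ¬T⇒T-not (λ t → NP.<⇒≱ (NP.<ᵇ⇒< a i (proj₁ (Equivalence.to T-∧ t))) i≤a)

outside-> : ∀ {a n i} → a + n < i → Outside a n i
outside-> {a} {n} {i} a+n<i = ¬T⇒T-not (λ t → NP.<⇒≱ a+n<i (NP.≤ᵇ⇒≤ i (a + n) (proj₂ (Equivalence.to T-∧ t))))

inRange-shift : ∀ k a n i → inRange (k + a) n (k + i) ≡ inRange a n i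
inRange-shift zero a n i = refl
inRange-shift (suc k) a n i = trans (cong ((k + a ℕ.<ᵇ k + i) ∧_) (≤ᵇ-suc (k + i) (k + a + n))) (inRange-shift k a n i)
  where
    ≤ᵇ-suc : ∀ m n → (suc m ℕ.≤ᵇ suc n) ≡ (m ℕ.≤ᵇ n)
    ≤ᵇ-suc zero    n = refl
    ≤ᵇ-suc (suc m) n = refl

restrict-++ : ∀ a n xs ys → restrict a n (xs ++ ys) ≡ restrict a n xs ++ restrict a n ys
restrict-++ a n xs ys = trans (cong (map (λ i → i ∸ a)) (filter-++ (λ i → T? (inRange a n i)) xs ys)) (map-++ _ (filterᵇ (inRange a n) xs) _)

restrict-outside : ∀ a n xs → All (Outside a n) xs → restrict a n xs ≡ []
restrict-outside a n xs os = cong (map (λ i → i ∸ a)) (filter-none (λ i → T? (inRange a n i)) (All.map T-not⇒¬T os))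

restrict-inside : ∀ a n xs → All (Inside a n) xs → restrict a n xs ≡ map (λ i → i ∸ a) xs
restrict-inside a n xs is = cong (map (λ i → i ∸ a)) (filter-all (λ i → T? (inRange a n i)) is)

restrict-shift : ∀ k a n xs → restrict (k + a) n (shift k xs) ≡ restrict a n xs
restrict-shift k a n [] = refl
restrict-shift k a n (x ∷ xs) rewrite inRange-shift k a n x with inRange a n x
... | true  = cong₂ _∷_ (NP.[m+n]∸[m+o]≡n∸o k x a) (restrict-shift k a n xs)
... | false = restrict-shift k a n xs

Consecutive : ℕ → ℕ → List ℕ → Set
Consecutive a n xs = ∃[ p ] ∃[ s ] ∃[ q ] ((xs ≡ p ++ s ++ q) × All (Outside a n) p × All (Inside a n) s × All (Outside a n) q)

Window : ℕ → ℕ → List ℕ → List ℕ → Set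
Window a n xs ys = Consecutive a n xs × restrict a n xs ≡ ys

window-inside : ∀ a n xs → All (Inside a n) xs → Window a n xs (map (λ i → i ∸ a) xs)
window-inside a n xs is = ([] , xs , [] , sym (++-identityʳ xs) , [] , is , []) , restrict-inside a n xs is

window-++ˡ : ∀ {a n xs ys} zs → All (Outside a n) zs → Window a n xs ys → Window a n (zs ++ xs) ys
window-++ˡ {a} {n} {xs} zs os ((p , s , q , xs≡ , op , is , oq) , r) =
  (zs ++ p , s , q , trans (cong (zs ++_) xs≡) (sym (++-assoc zs p _)) , ++⁺ os op , is , oq) ,
  trans (restrict-++ a n zs xs) (cong₂ _++_ (restrict-outside a n zs os) r)

window-++ʳ : ∀ {a n xs ys} zs → Window a n xs ys → All (Outside a n) zs → Window a n (xs ++ zs) ys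
window-++ʳ {a} {n} {xs} {ys} zs ((p , s , q , xs≡ , op , is , oq) , r) os =
  (p , s , q ++ zs , regroup , op , is , ++⁺ oq os) ,
  trans (restrict-++ a n xs zs) (trans (cong₂ _++_ r (restrict-outside a n zs os)) (++-identityʳ ys))
  where
    regroup : xs ++ zs ≡ p ++ s ++ q ++ zs
    regroup = trans (cong (_++ zs) xs≡) (trans (++-assoc p (s ++ q) zs) (cong (p ++_) (++-assoc s q zs)))

window-shift : ∀ k {a n xs ys} → Window a n xs ys → Window (k + a) n (shift k xs) ys
window-shift k {a} {n} {xs} ((p , s , q , xs≡ , op , is , oq) , r) =
  (shift k p , shift k s , shift k q , regroup ,
   map⁺ (All.map (transport {not}) op) , map⁺ (All.map (transport {λ x → x}) is) , map⁺ (All.map (transport {not}) oq)) ,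
  trans (restrict-shift k a n xs) r
  where
    transport : ∀ {b : Bool → Bool} {i} → T (b (inRange a n i)) → T (b (inRange (k + a) n (k + i)))
    transport {b} {i} = subst (λ x → T (b x)) (sym (inRange-shift k a n i))
    regroup : shift k xs ≡ shift k p ++ shift k s ++ shift k q
    regroup = trans (cong (shift k) xs≡) (trans (map-++ _ p (s ++ q)) (cong (shift k p ++_) (map-++ _ s q)))

all-inside-positions : ∀ {n} xs → All (Position n) xs → All (Inside 0 n) xs
all-inside-positions xs = All.map (λ (1≤i , i≤n) → inside 1≤i i≤n)

all-outside-positions : ∀ {m a n} xs → m ≤ a → All (Position m) xs → All (Outside a n) xs
all-outside-positions xs m≤a = All.map (λ (_ , i≤m) → outside-≤ (NP.≤-trans i≤m m≤a))

all-outside-shift : ∀ {m a n} k xs → a + n ≤ k → All (Position m) xs → All (Outside a n) (shift k xs)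
all-outside-shift {a = a} {n} k xs a+n≤k ps =
  map⁺ (All.map (λ {i} (1≤i , _) → outside-> (NP.≤-<-trans a+n≤k (NP.m<m+n k 1≤i))) ps)

even : ℕ → Bool
even zero = true
even (suc n) = not (even n)

even-%2 : ∀ c → (c % 2 ≡ 0 → even c ≡ true) × (c % 2 ≡ 1 → even c ≡ false)
even-%2 zero = (λ _ → refl) , (λ ())
even-%2 (suc zero) = (λ ()) , (λ _ → refl)
even-%2 (suc (suc c)) =
  (λ e → trans (not-involutive (even c)) (proj₁ (even-%2 c) (trans (sym %2-step) e))) ,
  (λ e → trans (not-involutive (even c)) (proj₂ (even-%2 c) (trans (sym %2-step) e)))
  where
    %2-step : suc (suc c) % 2 ≡ c % 2
    %2-step = trans (cong (_% 2) (NP.+-comm 2 c)) ([m+n]%n≡m%n c 2)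

seqOf : Bool → Tree → List ℕ
seqOf true = normalSeq
seqOf false = reversedSeq

SeqWindow : ℕ → ℕ → Tree → Tree → Set
SeqWindow a c T t = Window a (size t) (normalSeq T) (seqOf (even c) t) × Window a (size t) (reversedSeq T) (seqOf (not (even c)) t)

seqWindow-prefix : ∀ t r → SeqWindow 0 0 (t ++ₜ r) t
seqWindow-prefix t r = normal , reversed
  where
    n = size t
    inN = window-inside 0 n (normalSeq t) (all-inside-positions (normalSeq t) (all-position-normalSeq t))
    inR = window-inside 0 n (reversedSeq t) (all-inside-positions (reversedSeq t) (all-position-reversedSeq t))
    normal : Window 0 n (normalSeq (t ++ₜ r)) (normalSeq t)
    normal = subst₂ (Window 0 n) (sym (normalSeq-++ₜ t r)) (map-id (normalSeq t))
      (window-++ʳ (shift n (normalSeq r)) inN (all-outside-shift n (normalSeq r) NP.≤-refl (all-position-normalSeq r)))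
    reversed : Window 0 n (reversedSeq (t ++ₜ r)) (reversedSeq t)
    reversed = subst₂ (Window 0 n) (sym (reversedSeq-++ₜ t r)) (map-id (reversedSeq t))
      (window-++ˡ (shift n (reversedSeq r)) (all-outside-shift n (reversedSeq r) NP.≤-refl (all-position-reversedSeq r)) inR)

seqWindow-left : ∀ u v {a c t} → a + size t ≤ size u → SeqWindow a c u t → SeqWindow (suc a) (suc c) (node u v) t
seqWindow-left u v {a} {c} {t} fits (windowN , windowR) = normal , reversed
  where
    n = size t
    b = 2 + size u
    a+n<b : suc a + n < b
    a+n<b = s≤s (s≤s fits)
    a+n≤b : suc a + n ≤ b
    a+n≤b = NP.<⇒≤ a+n<b
    outside-1 : Outside (suc a) n 1
    outside-1 = outside-≤ {suc a} {n} (s≤s z≤n)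
    outside-b : Outside (suc a) n b
    outside-b = outside-> {suc a} {n} a+n<b
    normal : Window (suc a) n (normalSeq (node u v)) (seqOf (not (even c)) t)
    normal = window-++ˡ (b ∷ []) (outside-b ∷ [])
      (window-++ʳ (1 ∷ shift b (normalSeq v)) (window-shift 1 windowR)
        (outside-1 ∷ all-outside-shift b (normalSeq v) a+n≤b (all-position-normalSeq v)))
    reversed : Window (suc a) n (reversedSeq (node u v)) (seqOf (not (not (even c))) t)
    reversed = subst (λ e → Window (suc a) n (reversedSeq (node u v)) (seqOf e t)) (sym (not-involutive (even c)))
      (window-++ˡ (shift b (reversedSeq v)) (all-outside-shift b (reversedSeq v) a+n≤b (all-position-reversedSeq v))
        (window-++ˡ (1 ∷ []) (outside-1 ∷ [])
          (window-++ʳ (b ∷ []) (window-shift 1 windowN) (outside-b ∷ []))))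

seqWindow-right : ∀ u v {o c t} → SeqWindow o c v t → SeqWindow (2 + size u + o) c (node u v) t
seqWindow-right u v {o} {c} {t} (windowN , windowR) = normal , reversed
  where
    n = size t
    b = 2 + size u
    b≤a : b ≤ b + o
    b≤a = NP.m≤m+n b o
    outside-1 : Outside (b + o) n 1
    outside-1 = outside-≤ {b + o} {n} (NP.≤-trans (s≤s z≤n) b≤a)
    outside-b : Outside (b + o) n b
    outside-b = outside-≤ b≤a
    all-outside-u : ∀ xs → All (Position (size u)) xs → All (Outside (b + o) n) (shift 1 xs)
    all-outside-u xs ps = all-outside-positions (shift 1 xs) (NP.≤-trans (NP.n≤1+n (suc (size u))) b≤a) (all-position-shift 1 xs NP.≤-refl ps)
    normal : Window (b + o) n (normalSeq (node u v)) (seqOf (even c) t)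
    normal = subst (λ xs → Window (b + o) n xs (seqOf (even c) t)) (cong (b ∷_) (++-assoc (shift 1 (reversedSeq u)) (1 ∷ []) _))
      (window-++ˡ (b ∷ shift 1 (reversedSeq u) ++ 1 ∷ [])
        (outside-b ∷ ++⁺ (all-outside-u (reversedSeq u) (all-position-reversedSeq u)) (outside-1 ∷ []))
        (window-shift b windowN))
    reversed : Window (b + o) n (reversedSeq (node u v)) (seqOf (not (even c)) t)
    reversed = window-++ʳ (1 ∷ shift 1 (normalSeq u) ++ b ∷ []) (window-shift b windowR)
      (outside-1 ∷ ++⁺ (all-outside-u (normalSeq u) (all-position-normalSeq u)) (outside-b ∷ []))

take-dyck-node-right : ∀ u v o → take (2 + size u + o) (dyck (node u v)) ≡ hump u ++ take o (dyck v)
take-dyck-node-right u v o =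
  trans (cong₂ take (cong (_+ o) (sym (length-hump u))) (dyck-node-hump u v)) (take-length-+-++ (hump u) o (dyck v))

drop-dyck-node-right : ∀ u v o → drop (2 + size u + o) (dyck (node u v)) ≡ drop o (dyck v)
drop-dyck-node-right u v o =
  trans (cong₂ drop (cong (_+ o) (sym (length-hump u))) (dyck-node-hump u v)) (drop-length-+-++ (hump u) o (dyck v))

take-dyck-node-left : ∀ u v {a} → a ≤ size u → take (suc a) (dyck (node u v)) ≡ U ∷ take a (dyck u)
take-dyck-node-left u v {a} a≤u = cong (U ∷_) (take-++-≤ a (dyck u) (D ∷ dyck v) (subst (a ≤_) (sym (length-dyck u)) a≤u))

drop-dyck-node-left : ∀ u v {a} → a ≤ size u → drop (suc a) (dyck (node u v)) ≡ drop a (dyck u) ++ D ∷ dyck v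
drop-dyck-node-left u v {a} a≤u = drop-++-≤ a (dyck u) (D ∷ dyck v) (subst (a ≤_) (sym (length-dyck u)) a≤u)

length-drop-dyck : ∀ u a → length (drop a (dyck u)) ≡ size u ∸ a
length-drop-dyck u a = trans (length-drop a (dyck u)) (cong (_∸ a) (length-dyck u))

heightFrom-take-dyck-≥ : ∀ h t a → h ℤ.≤ heightFrom h (take a (dyck t))
heightFrom-take-dyck-≥ h t a = heightFrom-take-≥ h h (dyck t) a (downsBelow-dyck t h) ZP.≤-refl

heightFrom-1 : ∀ p c → heightFrom (+ 1) p ≡ + suc c → heightFrom (+ 0) p ≡ + c
heightFrom-1 p c e = ∙-cancelʳ (+ 1) _ _ (trans (sym (heightFrom-+ (+ 0) (+ 1) p)) (trans e (cong +_ (NP.+-comm 1 c))))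

-- Past the end of dyck u the path drops to height 0, below the window's base line c + 1.
window-left-fits : ∀ u v {a c t} → a ≤ size u → heightFrom (+ 1) (take a (dyck u)) ≡ + suc c →
  take (size t) (drop a (dyck u) ++ D ∷ dyck v) ≡ dyck t → a + size t ≤ size u
window-left-fits u v {a} {c} {t} a≤u hA w with a + size t ℕ.≤? size u
... | yes fits = fits
... | no ¬fits with subst (+ suc c ℤ.≤_) (trans (cong (heightFrom (+ suc c)) prefix) height)
                         (heightFrom-take-dyck-≥ (+ suc c) t (suc m))
  where
    open ≡-Reasoning
    r = drop a (dyck u)
    m = length r
    m<n : suc m ≤ size t
    m<n = subst (λ k → suc k ≤ size t) (sym (length-drop-dyck u a))
            (subst (size u ∸ a <_) (NP.m+n∸m≡n a (size t)) (NP.∸-monoˡ-< (NP.≰⇒> ¬fits) a≤u))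
    prefix : take (suc m) (dyck t) ≡ r ++ D ∷ []
    prefix = begin
      take (suc m) (dyck t)                        ≡⟨ cong (take (suc m)) (sym w) ⟩
      take (suc m) (take (size t) (r ++ D ∷ dyck v)) ≡⟨ take-take (suc m) (size t) _ ⟩
      take (suc m ℕ.⊓ size t) (r ++ D ∷ dyck v)     ≡⟨ cong (λ k → take k (r ++ D ∷ dyck v)) (trans (NP.m≤n⇒m⊓n≡m m<n) (NP.+-comm 1 m)) ⟩
      take (m + 1) (r ++ D ∷ dyck v)               ≡⟨ take-length-+-++ r 1 (D ∷ dyck v) ⟩
      r ++ D ∷ [] ∎
    height : heightFrom (+ suc c) (r ++ D ∷ []) ≡ + 0
    height = begin
      heightFrom (+ suc c) (r ++ D ∷ [])                      ≡⟨ heightFrom-++ (+ suc c) r (D ∷ []) ⟩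
      move D (heightFrom (+ suc c) r)                         ≡⟨ cong (λ h → move D (heightFrom h r)) (sym hA) ⟩
      move D (heightFrom (heightFrom (+ 1) (take a (dyck u))) r) ≡⟨ cong (move D) (sym (heightFrom-++ (+ 1) (take a (dyck u)) r)) ⟩
      move D (heightFrom (+ 1) (take a (dyck u) ++ r))         ≡⟨ cong (λ p → move D (heightFrom (+ 1) p)) (take++drop≡id a (dyck u)) ⟩
      move D (heightFrom (+ 1) (dyck u))                      ≡⟨ cong (move D) (heightFrom-dyck u (+ 1)) ⟩
      + 0 ∎
...   | ℤ.+≤+ ()

Embedded : ℕ → ℕ → Tree → Tree → Set
Embedded a c T t = a + size t ≤ size T × heightFrom (+ 0) (take a (dyck T)) ≡ + c × take (size t) (drop a (dyck T)) ≡ dyck t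

embedded-left-base : ∀ u v {a t} → a ≤ size u → ¬ Embedded (suc a) 0 (node u v) t
embedded-left-base u v {a} a≤u (_ , hA , _)
  with subst (+ 1 ℤ.≤_) (trans (cong (heightFrom (+ 0)) (sym (take-dyck-node-left u v a≤u))) hA) (heightFrom-take-dyck-≥ (+ 1) u a)
... | ℤ.+≤+ ()

embedded-left : ∀ u v {a c t} → a ≤ size u → Embedded (suc a) (suc c) (node u v) t → Embedded a c u t
embedded-left u v {a} {c} {t} a≤u (_ , hA , w) = fits , heightFrom-1 (take a (dyck u)) c hA₁ , trans (sym (take-++-≤ (size t) (drop a (dyck u)) (D ∷ dyck v) n≤)) w₁
  where
    hA₁ : heightFrom (+ 1) (take a (dyck u)) ≡ + suc c
    hA₁ = trans (cong (heightFrom (+ 0)) (sym (take-dyck-node-left u v a≤u))) hA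
    w₁ : take (size t) (drop a (dyck u) ++ D ∷ dyck v) ≡ dyck t
    w₁ = trans (cong (take (size t)) (sym (drop-dyck-node-left u v a≤u))) w
    fits : a + size t ≤ size u
    fits = window-left-fits u v a≤u hA₁ w₁
    n≤ : size t ≤ length (drop a (dyck u))
    n≤ = subst (size t ≤_) (sym (length-drop-dyck u a))
           (subst (_≤ size u ∸ a) (NP.m+n∸m≡n a (size t)) (NP.∸-monoˡ-≤ a fits))

embedded-right : ∀ u v {o c t} → Embedded (2 + size u + o) c (node u v) t → Embedded o c v t
embedded-right u v {o} {c} {t} (bound , hA , w) = bound′ , hA′ , trans (cong (take (size t)) (sym (drop-dyck-node-right u v o))) w
  where
    bound′ : o + size t ≤ size v
    bound′ = NP.+-cancelˡ-≤ (2 + size u) _ _ (subst₂ _≤_ (NP.+-assoc (2 + size u) o (size t)) (size-node u v) bound)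
    hA′ : heightFrom (+ 0) (take o (dyck v)) ≡ + c
    hA′ = begin
      heightFrom (+ 0) (take o (dyck v))                          ≡⟨ cong (λ h → heightFrom h (take o (dyck v))) (sym (heightFrom-hump u)) ⟩
      heightFrom (heightFrom (+ 0) (hump u)) (take o (dyck v))    ≡⟨ sym (heightFrom-++ (+ 0) (hump u) _) ⟩
      heightFrom (+ 0) (hump u ++ take o (dyck v))                ≡⟨ cong (heightFrom (+ 0)) (sym (take-dyck-node-right u v o)) ⟩
      heightFrom (+ 0) (take (2 + size u + o) (dyck (node u v)))  ≡⟨ hA ⟩
      + c ∎
      where open ≡-Reasoning

seqWindow : ∀ T a c t → Embedded a c T t → SeqWindow a c T t
seqWindow T zero zero t (_ , _ , w) with dyck-prefix T t _ (trans (sym (take++drop≡id (size t) (dyck T))) (cong (_++ drop (size t) (dyck T)) w))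
... | r , refl = seqWindow-prefix t r
seqWindow (node u v) (suc a) c t e with a ℕ.≤? size u
seqWindow (node u v) (suc a) zero t e | yes a≤u = ⊥-elim (embedded-left-base u v a≤u e)
seqWindow (node u v) (suc a) (suc c) t e | yes a≤u =
  seqWindow-left u v {c = c} (proj₁ (embedded-left u v a≤u e)) (seqWindow u a c t (embedded-left u v a≤u e))
seqWindow (node u v) (suc a) c t e | no a≰u with NP.m≤n⇒∃[o]m+o≡n (NP.≰⇒> a≰u)
... | o , refl = seqWindow-right u v {c = c} (seqWindow v o c t (embedded-right u v e))

canonicalForm-dyck : ∀ t → 1 ≤ size t → CanonicalForm (dyck t)
canonicalForm-dyck (node u v) _ = canonicalForm-dyck-node u v

πPerm-window : ∀ T t {a c} → Embedded a c T t → Window a (size t) (πPerm (dyck T)) (seqOf (even c) t)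
πPerm-window T t {a} {c} e = subst (λ xs → Window a (size t) xs (seqOf (even c) t)) (sym (πPerm-dyck T)) (proj₁ (seqWindow T a c t e))

seqOf-even : ∀ c t → c % 2 ≡ 0 → seqOf (even c) t ≡ πPerm (dyck t)
seqOf-even c t c-even = trans (cong (λ b → seqOf b t) (proj₁ (even-%2 c) c-even)) (sym (πPerm-dyck t))

seqOf-odd : ∀ c t → c % 2 ≡ 1 → seqOf (even c) t ≡ reflect (length (dyck t)) (πPerm (revBar (dyck t)))
seqOf-odd c t c-odd = begin
  seqOf (even c) t                                    ≡⟨ cong (λ b → seqOf b t) (proj₂ (even-%2 c) c-odd) ⟩
  reversedSeq t                                       ≡⟨ sym (reflect-reflect (size t) (reversedSeq t) (all-position-reversedSeq t)) ⟩
  reflect (size t) (reflect (size t) (reversedSeq t)) ≡⟨ cong₂ reflect (sym (length-dyck t)) (sym (πPerm-revBar-dyck t)) ⟩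
  reflect (length (dyck t)) (πPerm (revBar (dyck t))) ∎
  where open ≡-Reasoning

lemma14 : (k : ℕ) → 1 ≤ k → (xh : Path) → InD0 k xh →
  (c a ℓ : ℕ) → 1 ≤ ℓ → a + (ℓ + ℓ) ≤ length xh →
  heightFrom (+ 0) (Data.List.take a xh) ≡ + c →
  heightFrom (+ c) (subpath a (ℓ + ℓ) xh) ≡ + c →
  downsBelow (+ c) (+ c) (subpath a (ℓ + ℓ) xh) ≡ 0 →
  (∃[ p ] ∃[ s ] ∃[ q ] ((πPerm xh ≡ p ++ s ++ q)
      × (All (λ i → T (not (inRange a (ℓ + ℓ) i))) p
      × (All (λ i → T (inRange a (ℓ + ℓ) i)) s
      × All (λ i → T (not (inRange a (ℓ + ℓ) i))) q))))
  × ((c % 2 ≡ 0 →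
        (restrict a (ℓ + ℓ) (πPerm xh) ≡ πPerm (subpath a (ℓ + ℓ) xh))
        × (πPerm (subpath a (ℓ + ℓ) xh) ≡
             (length (canonU (subpath a (ℓ + ℓ) xh)) + 2)
             ∷ (map (λ t → (length (canonU (subpath a (ℓ + ℓ) xh)) + 2) ∸ t)
                    (πPerm (revBar (canonU (subpath a (ℓ + ℓ) xh))))
                ++ (1 ∷ map (λ t → (length (canonU (subpath a (ℓ + ℓ) xh)) + 2) + t)
                            (πPerm (canonV (subpath a (ℓ + ℓ) xh)))))))
    × (c % 2 ≡ 1 →
        restrict a (ℓ + ℓ) (πPerm xh)
          ≡ map (λ t → suc (length (subpath a (ℓ + ℓ) xh)) ∸ t)
                (πPerm (revBar (subpath a (ℓ + ℓ) xh)))))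
lemma14 k _ xh inD0 c a ℓ 1≤ℓ bound hA hS dS with InD0⇒dyck k xh inD0
... | T , refl with dyckPath (+ c) (subpath a (ℓ + ℓ) (dyck T)) dS hS
...   | t , dyck-t =
  proj₁ window ,
  (λ c-even → trans (proj₂ window) (trans (seqOf-even c t c-even) (cong πPerm dyck-t)) ,
              subst CanonicalForm dyck-t (canonicalForm-dyck t (subst (1 ≤_) (sym size-t) (NP.≤-trans 1≤ℓ (NP.m≤m+n ℓ ℓ))))) ,
  (λ c-odd → trans (proj₂ window) (trans (seqOf-odd c t c-odd) (cong (λ p → reflect (length p) (πPerm (revBar p))) dyck-t)))
  where
    size-t : size t ≡ ℓ + ℓ
    size-t = trans (sym (length-dyck t)) (trans (cong length dyck-t) (length-subpath a (ℓ + ℓ) (dyck T) bound))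
    window : Window a (ℓ + ℓ) (πPerm (dyck T)) (seqOf (even c) t)
    window = subst (λ n → Window a n (πPerm (dyck T)) (seqOf (even c) t)) size-t
      (πPerm-window T t (subst (λ n → a + n ≤ size T) (sym size-t) (subst (a + (ℓ + ℓ) ≤_) (length-dyck T) bound) , hA ,
                         trans (cong (λ n → take n (drop a (dyck T))) size-t) (sym dyck-t)))
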